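{- Let $G$ be a finite simple graph, let $v$ be an articulation (cut vertex) of $G$, and let $H$ and $K$ be subgraphs of $G$ with $G=H\cup K$ and $H\cap K=(\{v\},\emptyset)$. Then, writing $Q(\cdot)$ for $Q(\cdot;x,y)$, \[ Q(G)=Q(H-v)\,Q(K-v)+\frac{1}{xy}\left[Q(H)-Q(H-v)\right]\left[Q(K)-Q(K-v)\right]. \]
   Context: For a finite simple graph $G=(V,E)$, $Q(G;x,y)=\sum_{X\subseteq V}x^{|X|}y^{k(G[X])}$, where $G[X]$ is the induced subgraph and $k$ the number of connected components (the null graph has $k=0$). An articulation is a vertex whose removal increases the number of components. $H-v$ denotes removal of $v$ and its incident edges. -}

module Defs where

open import Data.Bool using (Bool; true; false; _∧_; _∨_; not; if_then_else_)
open import Data.Nat as ℕ using (ℕ; zero; suc; _<ᵇ_)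
open import Data.Fin using (Fin; toℕ; _≟_)
open import Data.List using (List; []; _∷_; _++_; map; foldr)
open import Data.Bool.ListAction using (any; all)
open import Data.List using () renaming (allFin to allFinL)
open import Data.Vec.Functional using () renaming (_∷_ to _∷ᶠ_)
open import Data.Integer as ℤ using (ℤ)
open import Relation.Binary.PropositionalEquality using (_≡_)
open import Relation.Nullary.Decidable using (⌊_⌋)

-- A graph with vertex set a subset of the ambient finite set Fin n.
-- V u : u is a vertex; E u w : {u,w} is an edge.
record Graph (n : ℕ) : Set where
  field
    V : Fin n → Bool
    E : Fin n → Fin n → Bool
open Graph public

record IsSimpleGraph {n : ℕ} (G : Graph n) : Set where
  field
    E-sym     : ∀ u w → E G u w ≡ E G w u
    E-irrefl  : ∀ u → E G u u ≡ false
    E-V       : ∀ u w → E G u w ≡ true → V G u ≡ true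

_==ᶠ_ : {n : ℕ} → Fin n → Fin n → Bool
u ==ᶠ w = ⌊ u ≟ w ⌋

_─_ : {n : ℕ} → Graph n → Fin n → Graph n
V (G ─ v) u   = V G u ∧ not (u ==ᶠ v)
E (G ─ v) u w = E G u w ∧ not (u ==ᶠ v) ∧ not (w ==ᶠ v)

record _⊆ᴳ_ {n : ℕ} (H G : Graph n) : Set where
  field
    V⊆ : ∀ u → V H u ≡ true → V G u ≡ true
    E⊆ : ∀ u w → E H u w ≡ true → E G u w ≡ true

record IsUnion {n : ℕ} (G H K : Graph n) : Set where
  field
    V∪ : ∀ u → V G u ≡ (V H u ∨ V K u)
    E∪ : ∀ u w → E G u w ≡ (E H u w ∨ E K u w)

record IsIntersectionSingleVertex {n : ℕ} (H K : Graph n) (v : Fin n) : Set where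
  field
    V∩ : ∀ u → (V H u ∧ V K u) ≡ (u ==ᶠ v)
    E∩ : ∀ u w → (E H u w ∧ E K u w) ≡ false

-- Connectivity in the induced subgraph on X (X a vertex subset, E the edge relation):
-- reach m X E u w : there is a walk in G[X] from u to w with at most m edges.
reach : {n : ℕ} → ℕ → (Fin n → Bool) → (Fin n → Fin n → Bool) → Fin n → Fin n → Bool
reach zero X E u w = X u ∧ (u ==ᶠ w)
reach {n} (suc m) X E u w =
  reach m X E u w ∨ any (λ z → reach m X E u z ∧ X w ∧ E z w) (allFinL n)

connected : {n : ℕ} → (Fin n → Bool) → (Fin n → Fin n → Bool) → Fin n → Fin n → Bool
connected {n} = reach n

countB : {n : ℕ} → (Fin n → Bool) → ℕ
countB {n} p = foldr (λ u acc → if p u then suc acc else acc) 0 (allFinL n)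

-- number of connected components of G[X]: count the vertices of X that are the
-- least (in the order of Fin n) vertex of their component.  (Null graph: 0.)
components : {n : ℕ} → (Fin n → Bool) → (Fin n → Fin n → Bool) → ℕ
components X E =
  countB (λ u → X u ∧ not (any (λ w → (toℕ w <ᵇ toℕ u) ∧ connected X E w u) (allFinL _)))

k : {n : ℕ} → Graph n → ℕ
k G = components (V G) (E G)

IsArticulation : {n : ℕ} → Graph n → Fin n → Set
IsArticulation G v = (V G v ≡ true) × (k G ℕ.< k (G ─ v))
  where open import Data.Product using (_×_)

subsets : (n : ℕ) → List (Fin n → Bool)
subsets zero = (λ ()) ∷ []
subsets (suc n) = map (false ∷ᶠ_) (subsets n) ++ map (true ∷ᶠ_) (subsets n)

sumℤ : List ℤ → ℤ
sumℤ = foldr ℤ._+_ (ℤ.+ 0)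

-- Q(G;x,y) = Σ_{X ⊆ V(G)} x^|X| y^{k(G[X])}, evaluated at integers x, y
Q : {n : ℕ} → Graph n → ℤ → ℤ → ℤ
Q {n} G x y = sumℤ (map term (subsets n))
  where
  term : (Fin n → Bool) → ℤ
  term X = if all (λ u → not (X u) ∨ V G u) (allFinL n)
           then x ℤ.^ countB X ℤ.* y ℤ.^ components X (E G)
           else ℤ.+ 0

module Submission where

-- Write Q(G) = Σ_X t_G(X) with t_G(X) = [X ⊆ V(G)] x^|X| y^k(G[X]) and split the sum by
-- whether v ∈ X.  A vertex set Y of G is glued from Y_H = Y ∩ V(H) and Y_K = Y ∩ V(K),
-- which share at most v, and the combinatorial heart of the proof is
--   |Y| + [v ∈ Y] = |Y_H| + |Y_K|   and   k(G[Y]) + [v ∈ Y] = k(H[Y_H]) + k(K[Y_K]),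
-- i.e. (xy)^[v ∈ Y] t_G(Y) = t_H(Y_H) t_K(Y_K).  Splitting every subset X along
-- s = V(H − v), a product formula for sums over subsets then shows that the subsets avoiding
-- v contribute Q(H−v)Q(K−v), and, after inserting v, that xy times the contribution of the
-- subsets containing v is (Q(H)−Q(H−v))(Q(K)−Q(K−v)).

open import Defs
open import Data.Nat using (ℕ)
open import Data.Fin using (Fin)
open import Data.Integer using (ℤ; _+_; _-_; _*_)
open import Relation.Binary.PropositionalEquality using (_≡_)

open import Data.Bool using (Bool; true; false; _∧_; _∨_; not; if_then_else_; T)
open import Data.Bool.ListAction using (any; all)
import Data.Bool.Properties as BP
open import Data.Empty using (⊥; ⊥-elim)
open import Data.Unit using (tt)
open import Data.Fin as F using (toℕ; zero; suc)
import Data.Fin.Properties as FP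
open import Data.Integer.Tactic.RingSolver using (solve-∀)
open import Data.Nat.Tactic.RingSolver using () renaming (solve-∀ to ℕsolve-∀)
import Data.Integer as ℤ
import Data.Integer.Properties as ℤP
open import Data.List as L using (List; []; _∷_; _++_; map; foldr; allFin; length)
import Data.List.Properties as LP
open import Data.List.Membership.Propositional using (_∈_)
open import Data.List.Membership.Propositional.Properties using (∈-allFin)
open import Data.List.Relation.Unary.Any using (here; there)
open import Data.Nat as ℕ using (_<ᵇ_; _≤_; _<_; z≤n; s≤s) renaming (_+_ to _+ₙ_)
import Data.Nat.Properties as ℕP
open import Data.Product using (Σ; _×_; _,_; proj₁; proj₂)
open import Data.Sum using (_⊎_; inj₁; inj₂)
open import Data.Vec.Functional using () renaming (_∷_ to _∷ᶠ_)
open import Relation.Binary.Definitions using (tri<; tri≈; tri>)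
open import Relation.Binary.PropositionalEquality
  using (_≢_; refl; sym; trans; cong; cong₂; subst; module ≡-Reasoning)
open import Relation.Nullary using (¬_; yes; no)

∧-trueˡ : ∀ {a b} → (a ∧ b) ≡ true → a ≡ true
∧-trueˡ {true} _ = refl

∧-trueʳ : ∀ {a b} → (a ∧ b) ≡ true → b ≡ true
∧-trueʳ {true} e = e

∧-true : ∀ {a b} → a ≡ true → b ≡ true → (a ∧ b) ≡ true
∧-true refl refl = refl

∨-true : ∀ {a b} → (a ∨ b) ≡ true → (a ≡ true) ⊎ (b ≡ true)
∨-true {true} _ = inj₁ refl
∨-true {false} e = inj₂ e

∨-trueˡ : ∀ {a b} → a ≡ true → (a ∨ b) ≡ true
∨-trueˡ refl = refl

∨-trueʳ : ∀ {a b} → b ≡ true → (a ∨ b) ≡ true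
∨-trueʳ {true} _ = refl
∨-trueʳ {false} e = e

true-and-false : ∀ {a} → a ≡ true → a ≡ false → ⊥
true-and-false refl ()

¬true⇒false : ∀ {a} → ¬ (a ≡ true) → a ≡ false
¬true⇒false {true} h = ⊥-elim (h refl)
¬true⇒false {false} _ = refl

not-true⇒false : ∀ {a} → not a ≡ true → a ≡ false
not-true⇒false {false} _ = refl

not-false⇒true : ∀ {a} → not a ≡ false → a ≡ true
not-false⇒true {true} _ = refl

≡-from-⇔ : ∀ {a b} → (a ≡ true → b ≡ true) → (b ≡ true → a ≡ true) → a ≡ b
≡-from-⇔ {true} f g = sym (f refl)
≡-from-⇔ {false} {true} f g = g refl
≡-from-⇔ {false} {false} f g = refl

==-refl : ∀ {n} (u : Fin n) → (u ==ᶠ u) ≡ true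
==-refl u with u F.≟ u
... | yes _ = refl
... | no u≢u = ⊥-elim (u≢u refl)

≡⇒== : ∀ {n} {u w : Fin n} → u ≡ w → (u ==ᶠ w) ≡ true
≡⇒== {u = u} refl = ==-refl u

==⇒≡ : ∀ {n} {u w : Fin n} → (u ==ᶠ w) ≡ true → u ≡ w
==⇒≡ {u = u} {w} e with u F.≟ w
... | yes u≡w = u≡w

≢⇒==false : ∀ {n} {u w : Fin n} → u ≢ w → (u ==ᶠ w) ≡ false
≢⇒==false u≢w = ¬true⇒false (λ e → u≢w (==⇒≡ e))

==-suc : ∀ {n} (u w : Fin n) → (suc u ==ᶠ suc w) ≡ (u ==ᶠ w)
==-suc u w = ≡-from-⇔ (λ e → ≡⇒== (FP.suc-injective (==⇒≡ e))) (λ e → ≡⇒== (cong suc (==⇒≡ e)))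

==-∧ : ∀ {n} (f : Fin n → Bool) (c u : Fin n) → ((u ==ᶠ c) ∧ f u) ≡ ((u ==ᶠ c) ∧ f c)
==-∧ f c u with u ==ᶠ c in e
... | true rewrite ==⇒≡ e = refl
... | false = refl

_≺_ : ∀ {n} → Fin n → Fin n → Bool
w ≺ u = toℕ w <ᵇ toℕ u

≺⇒< : ∀ {n} {w u : Fin n} → (w ≺ u) ≡ true → toℕ w < toℕ u
≺⇒< {w = w} {u} e = ℕP.<ᵇ⇒< (toℕ w) (toℕ u) (subst T (sym e) tt)

<⇒≺ : ∀ {n} {w u : Fin n} → toℕ w < toℕ u → (w ≺ u) ≡ true
<⇒≺ p = T⇒≡ (ℕP.<⇒<ᵇ p)
  where
  T⇒≡ : ∀ {b} → T b → b ≡ true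
  T⇒≡ {true} _ = refl

≮⇒≺false : ∀ {n} {w u : Fin n} → ¬ (toℕ w < toℕ u) → (w ≺ u) ≡ false
≮⇒≺false h = ¬true⇒false (λ e → h (≺⇒< e))

module _ {A : Set} where

  any-intro : (p : A → Bool) {x : A} {xs : List A} → x ∈ xs → p x ≡ true → any p xs ≡ true
  any-intro p (here refl) e = ∨-trueˡ e
  any-intro p {xs = y ∷ ys} (there x∈ys) e = ∨-trueʳ {p y} (any-intro p x∈ys e)

  any-elim : (p : A → Bool) (xs : List A) → any p xs ≡ true → Σ A λ x → p x ≡ true
  any-elim p (y ∷ ys) e with ∨-true {p y} e
  ... | inj₁ py = y , py
  ... | inj₂ rest = any-elim p ys rest

  any-cong : {p q : A → Bool} (xs : List A) → (∀ x → p x ≡ q x) → any p xs ≡ any q xs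
  any-cong [] h = refl
  any-cong (y ∷ ys) h = cong₂ _∨_ (h y) (any-cong ys h)

  any-false : (p : A → Bool) (xs : List A) → (∀ x → p x ≡ false) → any p xs ≡ false
  any-false p [] h = refl
  any-false p (y ∷ ys) h rewrite h y = any-false p ys h

  any-∨ : (p q : A → Bool) (xs : List A) → any (λ x → p x ∨ q x) xs ≡ (any p xs ∨ any q xs)
  any-∨ p q [] = refl
  any-∨ p q (y ∷ ys) rewrite any-∨ p q ys with p y | q y
  ... | true | _ = refl
  ... | false | true = sym (BP.∨-zeroʳ (any p ys))
  ... | false | false = refl

  any-∧ˡ : (b : Bool) (p : A → Bool) (xs : List A) → any (λ x → b ∧ p x) xs ≡ (b ∧ any p xs)
  any-∧ˡ true p xs = refl
  any-∧ˡ false p xs = any-false _ xs (λ _ → refl)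

  all-intro : (p : A → Bool) (xs : List A) → (∀ x → p x ≡ true) → all p xs ≡ true
  all-intro p [] h = refl
  all-intro p (y ∷ ys) h rewrite h y = all-intro p ys h

  all-elim : (p : A → Bool) {x : A} {xs : List A} → all p xs ≡ true → x ∈ xs → p x ≡ true
  all-elim p {xs = y ∷ ys} e (here refl) = ∧-trueˡ e
  all-elim p {xs = y ∷ ys} e (there x∈ys) = all-elim p (∧-trueʳ {p y} e) x∈ys

  all-cong : {p q : A → Bool} (xs : List A) → (∀ x → p x ≡ q x) → all p xs ≡ all q xs
  all-cong [] h = refl
  all-cong (y ∷ ys) h = cong₂ _∧_ (h y) (all-cong ys h)

  count : (A → Bool) → List A → ℕ
  count p = foldr (λ u acc → if p u then ℕ.suc acc else acc) 0

  count-cong : {p q : A → Bool} (xs : List A) → (∀ x → p x ≡ q x) → count p xs ≡ count q xs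
  count-cong [] h = refl
  count-cong {p} {q} (y ∷ ys) h rewrite h y with q y
  ... | true = cong ℕ.suc (count-cong ys h)
  ... | false = count-cong ys h

  count-∨ : (p q : A → Bool) (xs : List A) → (∀ x → (p x ∧ q x) ≡ false) →
            count (λ x → p x ∨ q x) xs ≡ count p xs +ₙ count q xs
  count-∨ p q [] h = refl
  count-∨ p q (y ∷ ys) h with p y | q y | h y
  ... | true | false | _ = cong ℕ.suc (count-∨ p q ys h)
  ... | false | true | _ = trans (cong ℕ.suc (count-∨ p q ys h)) (sym (ℕP.+-suc _ _))
  ... | false | false | _ = count-∨ p q ys h

  count-split : (p r : A → Bool) (xs : List A) →
                count p xs ≡ count (λ x → p x ∧ r x) xs +ₙ count (λ x → p x ∧ not (r x)) xs
  count-split p r xs = trans (count-cong xs split) (count-∨ _ _ xs disjoint)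
    where
    split : ∀ x → p x ≡ ((p x ∧ r x) ∨ (p x ∧ not (r x)))
    split x with p x | r x
    ... | true | true = refl
    ... | true | false = refl
    ... | false | _ = refl
    disjoint : ∀ x → ((p x ∧ r x) ∧ (p x ∧ not (r x))) ≡ false
    disjoint x with p x | r x
    ... | true | true = refl
    ... | true | false = refl
    ... | false | _ = refl

  count-≤-length : (p : A → Bool) (xs : List A) → count p xs ≤ length xs
  count-≤-length p [] = z≤n
  count-≤-length p (y ∷ ys) with p y
  ... | true = s≤s (count-≤-length p ys)
  ... | false = ℕP.m≤n⇒m≤1+n (count-≤-length p ys)

  count-mono : (p q : A → Bool) (xs : List A) → (∀ x → p x ≡ true → q x ≡ true) →
               count p xs ≤ count q xs
  count-mono p q [] h = z≤n
  count-mono p q (y ∷ ys) h with p y in ep | q y in eq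
  ... | true | true = s≤s (count-mono p q ys h)
  ... | true | false = ⊥-elim (true-and-false (h y ep) eq)
  ... | false | true = ℕP.m≤n⇒m≤1+n (count-mono p q ys h)
  ... | false | false = count-mono p q ys h

  count-mono-≡ : (p q : A → Bool) (xs : List A) → (∀ x → p x ≡ true → q x ≡ true) →
                 count p xs ≡ count q xs → ∀ {x} → x ∈ xs → q x ≡ p x
  count-mono-≡ p q (y ∷ ys) h e x∈ with p y in ep | q y in eq
  count-mono-≡ p q (y ∷ ys) h e (here refl) | true | true = trans eq (sym ep)
  count-mono-≡ p q (y ∷ ys) h e (there x∈) | true | true = count-mono-≡ p q ys h (ℕP.suc-injective e) x∈
  ... | true | false = ⊥-elim (true-and-false (h y ep) eq)
  ... | false | true = ⊥-elim (ℕP.<-irrefl e (s≤s (count-mono p q ys h)))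
  count-mono-≡ p q (y ∷ ys) h e (here refl) | false | false = trans eq (sym ep)
  count-mono-≡ p q (y ∷ ys) h e (there x∈) | false | false = count-mono-≡ p q ys h e x∈

countB-cong : ∀ {n} {p q : Fin n → Bool} → (∀ x → p x ≡ q x) → countB p ≡ countB q
countB-cong {n} = count-cong (allFin n)

countB-≤ : ∀ {n} (p : Fin n → Bool) → countB p ≤ n
countB-≤ {n} p = subst (countB p ≤_) (LP.length-tabulate (λ i → i)) (count-≤-length p (allFin n))

countB-split : ∀ {n} (p r : Fin n → Bool) →
               countB p ≡ countB (λ x → p x ∧ r x) +ₙ countB (λ x → p x ∧ not (r x))
countB-split {n} p r = count-split p r (allFin n)

count-map : ∀ {A B : Set} (p : B → Bool) (f : A → B) (xs : List A) →
            count p (map f xs) ≡ count (λ x → p (f x)) xs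
count-map p f [] = refl
count-map p f (y ∷ ys) with p (f y)
... | true = cong ℕ.suc (count-map p f ys)
... | false = count-map p f ys

countB-tail : ∀ {n} (p : Fin (ℕ.suc n) → Bool) → count p (L.tabulate suc) ≡ countB (λ i → p (suc i))
countB-tail {n} p = trans (cong (count p) (sym (LP.map-tabulate (λ i → i) suc))) (count-map p suc (allFin n))

countB-suc : ∀ {n} (p : Fin (ℕ.suc n) → Bool) →
  countB p ≡ (if p zero then ℕ.suc (countB (λ i → p (suc i))) else countB (λ i → p (suc i)))
countB-suc p with p zero
... | true = cong ℕ.suc (countB-tail p)
... | false = countB-tail p

countB-zero : ∀ {n} (p : Fin n → Bool) → (∀ x → p x ≡ false) → countB p ≡ 0
countB-zero {n} p h = count-zero (allFin n)
  where
  count-zero : (xs : List (Fin n)) → count p xs ≡ 0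
  count-zero [] = refl
  count-zero (y ∷ ys) rewrite h y = count-zero ys

countB-single : ∀ {n} (p : Fin n → Bool) (c : Fin n) → (∀ x → p x ≡ (x ==ᶠ c)) → countB p ≡ 1
countB-single {ℕ.suc n} p zero h rewrite countB-suc p | h zero | ==-refl {ℕ.suc n} zero =
  cong ℕ.suc (countB-zero _ (λ i → trans (h (suc i)) (≢⇒==false {u = suc i} {zero} λ ())))
countB-single {ℕ.suc n} p (suc c) h rewrite countB-suc p | h zero | ≢⇒==false {u = zero} {suc c} (λ ()) =
  countB-single _ c (λ i → trans (h (suc i)) (==-suc i c))

ind : Bool → ℕ
ind b = if b then 1 else 0

countB-point : ∀ {n} (p : Fin n → Bool) (c : Fin n) (b : Bool) →
               (∀ x → p x ≡ ((x ==ᶠ c) ∧ b)) → countB p ≡ ind b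
countB-point p c true h = countB-single p c (λ x → trans (h x) (BP.∧-identityʳ _))
countB-point p c false h = countB-zero p (λ x → trans (h x) (BP.∧-zeroʳ _))

module Reach {n : ℕ} (X : Fin n → Bool) (E : Fin n → Fin n → Bool) where

  R : ℕ → Fin n → Fin n → Bool
  R m = reach m X E

  LastEdge : ℕ → Fin n → Fin n → Set
  LastEdge m u w = Σ (Fin n) λ z → R m u z ≡ true × X w ≡ true × E z w ≡ true

  reach-suc-cases : ∀ m {u w} → R (ℕ.suc m) u w ≡ true → (R m u w ≡ true) ⊎ LastEdge m u w
  reach-suc-cases m {u} {w} e with ∨-true {R m u w} e
  ... | inj₁ shorter = inj₁ shorter
  ... | inj₂ extended with any-elim _ (allFin n) extended
  ... | z , last = inj₂ (z , ∧-trueˡ last , ∧-trueˡ (∧-trueʳ {R m u z} last) , ∧-trueʳ (∧-trueʳ {R m u z} last))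

  reach-source : ∀ m {u w} → R m u w ≡ true → X u ≡ true
  reach-source ℕ.zero e = ∧-trueˡ e
  reach-source (ℕ.suc m) e with reach-suc-cases m e
  ... | inj₁ shorter = reach-source m shorter
  ... | inj₂ (z , uz , _ , _) = reach-source m uz

  reach-target : ∀ m {u w} → R m u w ≡ true → X w ≡ true
  reach-target ℕ.zero {u} {w} e = subst (λ z → X z ≡ true) (==⇒≡ (∧-trueʳ e)) (∧-trueˡ e)
  reach-target (ℕ.suc m) e with reach-suc-cases m e
  ... | inj₁ shorter = reach-target m shorter
  ... | inj₂ (z , _ , Xw , _) = Xw

  reach-zero : ∀ {u} → X u ≡ true → R 0 u u ≡ true
  reach-zero {u} e = ∧-true e (==-refl u)

  reach-suc : ∀ m {u w} → R m u w ≡ true → R (ℕ.suc m) u w ≡ true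
  reach-suc m e = ∨-trueˡ e

  reach-step : ∀ m {u z w} → R m u z ≡ true → X w ≡ true → E z w ≡ true → R (ℕ.suc m) u w ≡ true
  reach-step m {u} {z} {w} uz Xw zw =
    ∨-trueʳ {R m u w} (any-intro (λ z' → R m u z' ∧ X w ∧ E z' w) (∈-allFin z) (∧-true uz (∧-true Xw zw)))

  reach-ind : (Φ : Fin n → Set) → ∀ {u} → (X u ≡ true → Φ u) →
              (∀ z w → Φ z → X z ≡ true → X w ≡ true → E z w ≡ true → Φ w) →
              ∀ m {w} → R m u w ≡ true → Φ w
  reach-ind Φ base step ℕ.zero e = subst Φ (==⇒≡ (∧-trueʳ e)) (base (∧-trueˡ e))
  reach-ind Φ base step (ℕ.suc m) e with reach-suc-cases m e
  ... | inj₁ shorter = reach-ind Φ base step m shorter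
  ... | inj₂ (z , uz , Xw , zw) = step z _ (reach-ind Φ base step m uz) (reach-target m uz) Xw zw

  reach-trans : ∀ a b {u z w} → R a u z ≡ true → R b z w ≡ true → R (b +ₙ a) u w ≡ true
  reach-trans a ℕ.zero {u} uz zw = subst (λ y → R a u y ≡ true) (==⇒≡ (∧-trueʳ zw)) uz
  reach-trans a (ℕ.suc b) uz zw with reach-suc-cases b zw
  ... | inj₁ shorter = reach-suc (b +ₙ a) (reach-trans a b uz shorter)
  ... | inj₂ (y , zy , Xw , yw) = reach-step (b +ₙ a) (reach-trans a b uz zy) Xw yw

  -- Saturation.  The reachable sets R 0 u ⊆ R 1 u ⊆ … grow until they stabilise, and
  -- since each step that is not stable adds a vertex, they are stable from step n on.
  Stable : Fin n → ℕ → Set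
  Stable u m = ∀ w → R (ℕ.suc m) u w ≡ R m u w

  stable-suc : ∀ {u} m → Stable u m → Stable u (ℕ.suc m)
  stable-suc {u} m st w = ≡-from-⇔ longer (reach-suc (ℕ.suc m))
    where
    longer : R (ℕ.suc (ℕ.suc m)) u w ≡ true → R (ℕ.suc m) u w ≡ true
    longer e with reach-suc-cases (ℕ.suc m) e
    ... | inj₁ shorter = shorter
    ... | inj₂ (z , uz , Xw , zw) = reach-step m (trans (sym (st z)) uz) Xw zw

  stable-≤′ : ∀ {u i j} → i ℕ.≤′ j → Stable u i → Stable u j
  stable-≤′ ℕ.≤′-refl st = st
  stable-≤′ {j = ℕ.suc j} (ℕ.≤′-step le) st = stable-suc j (stable-≤′ le st)

  reachCount : Fin n → ℕ → ℕ
  reachCount u m = countB (R m u)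

  stable-if-count-same : ∀ {u} m → reachCount u (ℕ.suc m) ≡ reachCount u m → Stable u m
  stable-if-count-same {u} m e w =
    count-mono-≡ (R m u) (R (ℕ.suc m) u) (allFin n) (λ x → reach-suc m) (sym e) (∈-allFin w)

  count-grows : ∀ {u} m → ¬ Stable u m → ℕ.suc (reachCount u m) ≤ reachCount u (ℕ.suc m)
  count-grows {u} m unstable =
    ℕP.≤∧≢⇒< (count-mono (R m u) (R (ℕ.suc m) u) (allFin n) (λ x → reach-suc m))
             (λ e → unstable (stable-if-count-same m (sym e)))

  stable-at-n : ∀ u → Stable u n
  stable-at-n u with reachCount u (ℕ.suc n) ℕ.≟ reachCount u n
  ... | yes same = stable-if-count-same n same
  ... | no grew = ⊥-elim (ℕP.<-irrefl refl (ℕP.<-≤-trans (grows n ℕP.≤-refl) (countB-≤ (R (ℕ.suc n) u))))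
    where
    -- stability at some i ≤ n would propagate to n and make the last two counts equal
    unstable : ∀ i → i ≤ n → ¬ Stable u i
    unstable i le st = grew (countB-cong (stable-≤′ (ℕP.≤⇒≤′ le) st))
    grows : ∀ i → i ≤ n → ℕ.suc i ≤ reachCount u (ℕ.suc i)
    grows ℕ.zero le = ℕP.≤-trans (s≤s z≤n) (count-grows 0 (unstable 0 le))
    grows (ℕ.suc i) le =
      ℕP.≤-trans (s≤s (grows i (ℕP.≤-trans (ℕP.n≤1+n i) le))) (count-grows (ℕ.suc i) (unstable (ℕ.suc i) le))

  reach-refl : ∀ m {u} → X u ≡ true → R m u u ≡ true
  reach-refl ℕ.zero Xu = reach-zero Xu
  reach-refl (ℕ.suc m) Xu = reach-suc m (reach-refl m Xu)

  saturate : ∀ m {u w} → R m u w ≡ true → R n u w ≡ true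
  saturate ℕ.zero {u} e = subst (λ w → R n u w ≡ true) (==⇒≡ (∧-trueʳ e)) (reach-refl n (∧-trueˡ e))
  saturate (ℕ.suc m) {u} {w} e with reach-suc-cases m e
  ... | inj₁ shorter = saturate m shorter
  ... | inj₂ (z , uz , Xw , zw) = trans (sym (stable-at-n u w)) (reach-step n (saturate m uz) Xw zw)

  C : Fin n → Fin n → Bool
  C = connected X E

  C-source : ∀ {u w} → C u w ≡ true → X u ≡ true
  C-source = reach-source n

  C-refl : ∀ {u} → X u ≡ true → C u u ≡ true
  C-refl = reach-refl n

  C-trans : ∀ {u z w} → C u z ≡ true → C z w ≡ true → C u w ≡ true
  C-trans uz zw = saturate (n +ₙ n) (reach-trans n n uz zw)

  C-step : ∀ {u z w} → C u z ≡ true → X w ≡ true → E z w ≡ true → C u w ≡ true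
  C-step uz Xw zw = saturate (ℕ.suc n) (reach-step n uz Xw zw)

  C-ind : (Φ : Fin n → Set) → ∀ {u} → (X u ≡ true → Φ u) →
          (∀ z w → Φ z → X z ≡ true → X w ≡ true → E z w ≡ true → Φ w) →
          ∀ {w} → C u w ≡ true → Φ w
  C-ind Φ base step = reach-ind Φ base step n

  C-sym : (∀ z w → E z w ≡ E w z) → ∀ {u w} → C u w ≡ true → C w u ≡ true
  C-sym E-sym {u} = C-ind (λ w → C w u ≡ true) C-refl
    (λ z w wu Xz Xw zw → C-trans (C-step (C-refl Xw) Xz (trans (E-sym w z) zw)) wu)

reach-transfer : ∀ {n} (X X' : Fin n → Bool) (E E' : Fin n → Fin n → Bool) →
  (∀ z → X z ≡ true → X' z ≡ true) →
  (∀ z w → X z ≡ true → X w ≡ true → E z w ≡ true → E' z w ≡ true) →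
  ∀ m {u w} → reach m X E u w ≡ true → reach m X' E' u w ≡ true
reach-transfer X X' E E' hX hE ℕ.zero {u} e = ∧-true (hX u (∧-trueˡ e)) (∧-trueʳ e)
reach-transfer X X' E E' hX hE (ℕ.suc m) e with Reach.reach-suc-cases X E m e
... | inj₁ shorter = Reach.reach-suc X' E' m (reach-transfer X X' E E' hX hE m shorter)
... | inj₂ (z , uz , Xw , zw) =
  Reach.reach-step X' E' m (reach-transfer X X' E E' hX hE m uz) (hX _ Xw)
    (hE z _ (Reach.reach-target X E m uz) Xw zw)

connected-transfer : ∀ {n} (X X' : Fin n → Bool) (E E' : Fin n → Fin n → Bool) →
  (∀ z → X z ≡ true → X' z ≡ true) →
  (∀ z w → X z ≡ true → X w ≡ true → E z w ≡ true → E' z w ≡ true) →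
  ∀ {u w} → connected X E u w ≡ true → connected X' E' u w ≡ true
connected-transfer {n} X X' E E' hX hE = reach-transfer X X' E E' hX hE n

leader : ∀ {n} → (Fin n → Bool) → (Fin n → Fin n → Bool) → Fin n → Bool
leader {n} X E u = X u ∧ not (any (λ w → (w ≺ u) ∧ connected X E w u) (allFin n))

components-cong : ∀ {n} (X X' : Fin n → Bool) (E E' : Fin n → Fin n → Bool) →
  (∀ z → X z ≡ X' z) → (∀ z w → X z ≡ true → X w ≡ true → E z w ≡ E' z w) →
  components X E ≡ components X' E'
components-cong {n} X X' E E' hX hE =
  countB-cong (λ u → cong₂ _∧_ (hX u) (cong not (any-cong (allFin n) (λ w → cong ((w ≺ u) ∧_) (C≡ w u)))))
  where
  hX' : ∀ z → X' z ≡ true → X z ≡ true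
  hX' z e = trans (hX z) e
  C≡ : ∀ w u → connected X E w u ≡ connected X' E' w u
  C≡ w u = ≡-from-⇔
    (connected-transfer X X' E E' (λ z e → trans (sym (hX z)) e) (λ z w Xz Xw e → trans (sym (hE z w Xz Xw)) e))
    (connected-transfer X' X E' E hX' (λ z w Xz Xw e → trans (hE z w (hX' z Xz) (hX' w Xw)) e))

least : ∀ {n} (p : Fin n → Bool) (c : Fin n) → p c ≡ true →
        Σ (Fin n) λ m → p m ≡ true × (∀ w → toℕ w < toℕ m → p w ≡ false)
least {ℕ.suc n} p c pc with p zero in p0
... | true = zero , p0 , (λ w ())
... | false with c
...   | zero = ⊥-elim (true-and-false pc p0)
...   | suc c' with least (λ i → p (suc i)) c' pc
...     | m , pm , below = suc m , pm , below′
  where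
  below′ : ∀ w → toℕ w < toℕ (suc m) → p w ≡ false
  below′ zero _ = p0
  below′ (suc w) (s≤s w<m) = below w w<m

module ComponentLeader {n : ℕ} (Y : Fin n → Bool) (E : Fin n → Fin n → Bool)
                       (E-sym : ∀ z w → E z w ≡ E w z) (v : Fin n) (Yv : Y v ≡ true) where
  open Reach Y E

  found : Σ (Fin n) λ m → C m v ≡ true × (∀ w → toℕ w < toℕ m → C w v ≡ false)
  found = least (λ w → C w v) v (C-refl Yv)

  m : Fin n
  m = proj₁ found

  m∼v : C m v ≡ true
  m∼v = proj₁ (proj₂ found)

  nothing-below-m : ∀ {w} → C w v ≡ true → ¬ (toℕ w < toℕ m)
  nothing-below-m {w} wv w<m = true-and-false wv (proj₂ (proj₂ found) w w<m)

  m≤v : toℕ m ≤ toℕ v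
  m≤v = ℕP.≮⇒≥ (nothing-below-m (C-refl Yv))

  Ym : Y m ≡ true
  Ym = C-source m∼v

  below-char : ∀ u → any (λ w → (w ≺ u) ∧ C w v) (allFin n) ≡ (m ≺ u)
  below-char u = ≡-from-⇔ some-below (λ m≺u → any-intro (λ w → (w ≺ u) ∧ C w v) (∈-allFin m) (∧-true m≺u m∼v))
    where
    some-below : any (λ w → (w ≺ u) ∧ C w v) (allFin n) ≡ true → (m ≺ u) ≡ true
    some-below e with any-elim _ (allFin n) e
    ... | w , w≺u∧wv = <⇒≺ {w = m} {u = u} (ℕP.≤-<-trans (ℕP.≮⇒≥ (nothing-below-m (∧-trueʳ {w ≺ u} w≺u∧wv)))
                                          (≺⇒< {w = w} {u = u} (∧-trueˡ w≺u∧wv)))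

  leader-char : ∀ u → (leader Y E u ∧ C v u) ≡ (u ==ᶠ m)
  leader-char u = ≡-from-⇔ is-m (λ e → is-leader (==⇒≡ e))
    where
    is-m : (leader Y E u ∧ C v u) ≡ true → (u ==ᶠ m) ≡ true
    is-m e with ℕP.<-cmp (toℕ u) (toℕ m)
    ... | tri< u<m _ _ = ⊥-elim (nothing-below-m (C-sym E-sym (∧-trueʳ {leader Y E u} e)) u<m)
    ... | tri≈ _ u≡m _ = ≡⇒== (FP.toℕ-injective u≡m)
    ... | tri> _ _ m<u = ⊥-elim (true-and-false
          (any-intro (λ w → (w ≺ u) ∧ C w u) (∈-allFin m) (∧-true (<⇒≺ {w = m} {u = u} m<u) (C-trans m∼v (∧-trueʳ {leader Y E u} e))))
          (BP.not-injective (∧-trueʳ {Y u} (∧-trueˡ e))))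
    is-leader : u ≡ m → (leader Y E u ∧ C v u) ≡ true
    is-leader refl = ∧-true (∧-true Ym (cong not (any-false _ (allFin n) none-below))) (C-sym E-sym m∼v)
      where
      none-below : ∀ w → ((w ≺ m) ∧ C w m) ≡ false
      none-below w with w ≺ m in w≺m | C w m in wm
      ... | true | true = ⊥-elim (nothing-below-m (C-trans wm m∼v) (≺⇒< {w = w} {u = m} w≺m))
      ... | true | false = refl
      ... | false | _ = refl

-- Gluing data: the vertex set X is the union of P and Q, which share at most the vertex v,
-- the edges of EG are those of EH and EK, and inside X the EH-edges stay in P and the
-- EK-edges stay in Q.  (This is G[X] = H[P] ∪ K[Q] with H ∩ K ⊆ {v}.)
record Gluing {n : ℕ} (X P Q : Fin n → Bool) (EG EH EK : Fin n → Fin n → Bool) (v : Fin n) : Set where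
  field
    X≡P∪Q   : ∀ z → X z ≡ (P z ∨ Q z)
    P∩Q⊆v   : ∀ z → P z ≡ true → Q z ≡ true → z ≡ v
    EG≡     : ∀ z w → EG z w ≡ (EH z w ∨ EK z w)
    EH-in-P : ∀ z w → X z ≡ true → X w ≡ true → EH z w ≡ true → P w ≡ true
    EK-in-Q : ∀ z w → X z ≡ true → X w ≡ true → EK z w ≡ true → Q w ≡ true
    EH-sym  : ∀ z w → EH z w ≡ EH w z
    EK-sym  : ∀ z w → EK z w ≡ EK w z

swap : ∀ {n X P Q EG EH EK v} → Gluing {n} X P Q EG EH EK v → Gluing {n} X Q P EG EK EH v
swap {P = P} {EH = EH} g = record
  { X≡P∪Q = λ z → trans (X≡P∪Q z) (BP.∨-comm (P z) _)
  ; P∩Q⊆v = λ z q p → P∩Q⊆v z p q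
  ; EG≡ = λ z w → trans (EG≡ z w) (BP.∨-comm (EH z w) _)
  ; EH-in-P = EK-in-Q ; EK-in-Q = EH-in-P ; EH-sym = EK-sym ; EK-sym = EH-sym }
  where open Gluing g

module GluedWalks {n : ℕ} {X P Q : Fin n → Bool} {EG EH EK : Fin n → Fin n → Bool} {v : Fin n}
                 (g : Gluing X P Q EG EH EK v) where
  open Gluing g
  module G = Reach X EG
  module H = Reach P EH
  module K = Reach Q EK

  H⊆G : ∀ {a b} → H.C a b ≡ true → G.C a b ≡ true
  H⊆G = connected-transfer P X EH EG (λ z p → trans (X≡P∪Q z) (∨-trueˡ p))
          (λ z w _ _ e → trans (EG≡ z w) (∨-trueˡ e))

  K⊆G : ∀ {a b} → K.C a b ≡ true → G.C a b ≡ true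
  K⊆G = connected-transfer Q X EK EG (λ z q → trans (X≡P∪Q z) (∨-trueʳ {P z} q))
          (λ z w _ _ e → trans (EG≡ z w) (∨-trueʳ {EH z w} e))

  -- Where a walk of G[X] starting in P can end: inside P, H-connected to its start,
  -- or inside Q after passing through v.
  Reached : Fin n → Fin n → Set
  Reached w z = (P z ≡ true × H.C w z ≡ true) ⊎ (Q z ≡ true × H.C w v ≡ true × K.C v z ≡ true)

  walk-from-P : ∀ {w z} → P w ≡ true → G.C w z ≡ true → Reached w z
  walk-from-P {w} Pw = G.C-ind (Reached w) (λ _ → inj₁ (Pw , H.C-refl Pw)) step
    where
    H-reached : ∀ {z} → P z ≡ true → Reached w z → H.C w z ≡ true
    H-reached Pz (inj₁ (_ , wz)) = wz
    H-reached Pz (inj₂ (Qz , wv , _)) = subst (λ y → H.C w y ≡ true) (sym (P∩Q⊆v _ Pz Qz)) wv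
    K-reached : ∀ {z} → Q z ≡ true → Reached w z → H.C w v ≡ true × K.C v z ≡ true
    K-reached {z} Qz (inj₁ (Pz , wz)) with P∩Q⊆v z Pz Qz
    ... | refl = wz , K.C-refl Qz
    K-reached Qz (inj₂ (_ , wv , vz)) = wv , vz
    step : ∀ z u → Reached w z → X z ≡ true → X u ≡ true → EG z u ≡ true → Reached w u
    step z u wz Xz Xu zu with ∨-true {EH z u} (trans (sym (EG≡ z u)) zu)
    ... | inj₁ Hzu =
      let Pz = EH-in-P u z Xu Xz (trans (EH-sym u z) Hzu)
          Pu = EH-in-P z u Xz Xu Hzu
      in inj₁ (Pu , H.C-step (H-reached Pz wz) Pu Hzu)
    ... | inj₂ Kzu =
      let Qz = EK-in-Q u z Xu Xz (trans (EK-sym u z) Kzu)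
          Qu = EK-in-Q z u Xz Xu Kzu
      in inj₂ (Qu , proj₁ (K-reached Qz wz) , K.C-step (proj₂ (K-reached Qz wz)) Qu Kzu)

module GluedLeaders {n : ℕ} {X P Q : Fin n → Bool} {EG EH EK : Fin n → Fin n → Bool} {v : Fin n}
                    (g : Gluing X P Q EG EH EK v) where
  open Gluing g
  open GluedWalks g
  module Other = GluedWalks (swap g)

  connected-into-P : ∀ {w u} → P u ≡ true → G.C w u ≡ (H.C w u ∨ (K.C w v ∧ H.C v u))
  connected-into-P {w} {u} Pu = ≡-from-⇔ split (join (H.C w u) refl)
    where
    split : G.C w u ≡ true → (H.C w u ∨ (K.C w v ∧ H.C v u)) ≡ true
    split wu with ∨-true {P w} (trans (sym (X≡P∪Q w)) (G.C-source wu))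
    ... | inj₁ Pw with walk-from-P Pw wu
    ...   | inj₁ (_ , Hwu) = ∨-trueˡ Hwu
    ...   | inj₂ (Qu , Hwv , _) rewrite P∩Q⊆v u Pu Qu = ∨-trueˡ Hwv
    split wu | inj₂ Qw with Other.walk-from-P Qw wu
    ...   | inj₁ (Qu , Kwu) with P∩Q⊆v u Pu Qu
    ...     | refl = ∨-trueʳ {H.C w v} (∧-true Kwu (H.C-refl Pu))
    split wu | inj₂ Qw | inj₂ (_ , Kwv , Hvu) = ∨-trueʳ {H.C w u} (∧-true Kwv Hvu)
    join : (b : Bool) → H.C w u ≡ b → (b ∨ (K.C w v ∧ H.C v u)) ≡ true → G.C w u ≡ true
    join true Hwu _ = H⊆G Hwu
    join false _ e = G.C-trans (K⊆G (∧-trueˡ e)) (H⊆G (∧-trueʳ {K.C w v} e))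

  K-below : Fin n → Bool
  K-below u = any (λ w → (w ≺ u) ∧ K.C w v) (allFin n)

  leader-in-P : ∀ {u} → P u ≡ true → leader X EG u ≡ (leader P EH u ∧ not (H.C v u ∧ K-below u))
  leader-in-P {u} Pu =
    begin
      X u ∧ not (any (λ w → (w ≺ u) ∧ G.C w u) (allFin n))
    ≡⟨ cong₂ (λ a b → a ∧ not b) (trans (X≡P∪Q u) (∨-trueˡ Pu)) (any-cong (allFin n) via-v) ⟩
      not (any (λ w → ((w ≺ u) ∧ H.C w u) ∨ (H.C v u ∧ ((w ≺ u) ∧ K.C w v))) (allFin n))
    ≡⟨ cong not (trans (any-∨ _ _ (allFin n)) (cong (H-below ∨_) (any-∧ˡ (H.C v u) _ (allFin n)))) ⟩
      not (H-below ∨ (H.C v u ∧ K-below u))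
    ≡⟨ not-∨ H-below _ ⟩
      not H-below ∧ not (H.C v u ∧ K-below u)
    ≡⟨ cong (λ a → (a ∧ not H-below) ∧ not (H.C v u ∧ K-below u)) (sym Pu) ⟩
      leader P EH u ∧ not (H.C v u ∧ K-below u)
    ∎
    where
    open ≡-Reasoning
    H-below : Bool
    H-below = any (λ w → (w ≺ u) ∧ H.C w u) (allFin n)
    not-∨ : ∀ a b → not (a ∨ b) ≡ (not a ∧ not b)
    not-∨ true b = refl
    not-∨ false b = refl
    distribute : ∀ l c k h → (l ∧ (c ∨ (k ∧ h))) ≡ ((l ∧ c) ∨ (h ∧ (l ∧ k)))
    distribute true true k h = refl
    distribute true false k h = BP.∧-comm k h
    distribute false c k h = sym (BP.∧-zeroʳ h)
    via-v : ∀ w → ((w ≺ u) ∧ G.C w u) ≡ (((w ≺ u) ∧ H.C w u) ∨ (H.C v u ∧ ((w ≺ u) ∧ K.C w v)))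
    via-v w = trans (cong ((w ≺ u) ∧_) (connected-into-P Pu)) (distribute (w ≺ u) (H.C w u) (K.C w v) (H.C v u))

-- Its leaders in P are counted by onP,
-- those outside P by offP; comparing with the leaders of H[P] and K[Q] gives
--   k(G[X]) = k(H[P]) + k(K[Q])        if v ∉ X,
--   k(G[X]) + 1 = k(H[P]) + k(K[Q])    if v ∈ P ∩ Q
-- (in the second case the components of v in H[P] and K[Q] merge into one).
module GluedComponents {n : ℕ} {X P Q : Fin n → Bool} {EG EH EK : Fin n → Fin n → Bool} {v : Fin n}
                       (g : Gluing X P Q EG EH EK v) where
  open Gluing g
  module H = Reach P EH
  module K = Reach Q EK
  module OnP = GluedLeaders g
  module OffP = GluedLeaders (swap g)

  leader-off-P : ∀ {u} → P u ≡ false → leader X EG u ≡ (leader Q EK u ∧ not (K.C v u ∧ OffP.K-below u))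
  leader-off-P {u} Pu = by-Q (Q u) refl
    where
    by-Q : (b : Bool) → Q u ≡ b → leader X EG u ≡ (leader Q EK u ∧ not (K.C v u ∧ OffP.K-below u))
    by-Q true Qu = OffP.leader-in-P Qu
    by-Q false Qu rewrite X≡P∪Q u | Pu | Qu = refl

  onP offP : ℕ
  onP = countB (λ u → leader P EH u ∧ not (H.C v u ∧ OnP.K-below u))
  offP = countB (λ u → leader Q EK u ∧ not (P u ∨ (K.C v u ∧ OffP.K-below u)))

  components-split : components X EG ≡ onP +ₙ offP
  components-split = trans (countB-split (leader X EG) P) (cong₂ _+ₙ_ (countB-cong in-P) (countB-cong off-P))
    where
    in-P : ∀ u → (leader X EG u ∧ P u) ≡ (leader P EH u ∧ not (H.C v u ∧ OnP.K-below u))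
    in-P u with P u in Pu
    ... | true rewrite OnP.leader-in-P Pu | Pu = BP.∧-identityʳ _
    ... | false = BP.∧-zeroʳ _
    off-P : ∀ u → (leader X EG u ∧ not (P u)) ≡ (leader Q EK u ∧ not (P u ∨ (K.C v u ∧ OffP.K-below u)))
    off-P u with P u in Pu
    ... | true = trans (BP.∧-zeroʳ _) (sym (BP.∧-zeroʳ _))
    ... | false rewrite leader-off-P Pu = BP.∧-identityʳ _

  glue-disjoint : P v ≡ false → Q v ≡ false → components X EG ≡ components P EH +ₙ components Q EK
  glue-disjoint Pv Qv = trans components-split (cong₂ _+ₙ_ (countB-cong on) (countB-cong off))
    where
    no-H-path : ∀ u → H.C v u ≡ false
    no-H-path u = ¬true⇒false (λ e → true-and-false (H.C-source e) Pv)
    no-K-path : ∀ u → K.C v u ≡ false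
    no-K-path u = ¬true⇒false (λ e → true-and-false (K.C-source e) Qv)
    on : ∀ u → (leader P EH u ∧ not (H.C v u ∧ OnP.K-below u)) ≡ leader P EH u
    on u rewrite no-H-path u = BP.∧-identityʳ _
    off : ∀ u → (leader Q EK u ∧ not (P u ∨ (K.C v u ∧ OffP.K-below u))) ≡ leader Q EK u
    off u rewrite no-K-path u with leader Q EK u in lead
    ... | false = refl
    ... | true with P u in Pu
    ...   | false = refl
    ...   | true with P∩Q⊆v u Pu (∧-trueˡ lead)
    ...     | refl = ⊥-elim (true-and-false (∧-trueˡ lead) Qv)

  module Shared (Pv : P v ≡ true) (Qv : Q v ≡ true) where
    module MH = ComponentLeader P EH EH-sym v Pv
    module MK = ComponentLeader Q EK EK-sym v Qv

    -- The leader of v's H-component is a G-leader unless the K-component of v reaches below it.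
    H-count : components P EH ≡ ind (MK.m ≺ MH.m) +ₙ onP
    H-count = trans (countB-split (leader P EH) (λ u → H.C v u ∧ OnP.K-below u))
                    (cong (_+ₙ onP) (countB-point _ MH.m (MK.m ≺ MH.m) at-mH))
      where
      at-mH : ∀ u → (leader P EH u ∧ (H.C v u ∧ OnP.K-below u)) ≡ ((u ==ᶠ MH.m) ∧ (MK.m ≺ MH.m))
      at-mH u = trans (sym (BP.∧-assoc (leader P EH u) _ _))
                (trans (cong₂ _∧_ (MH.leader-char u) (MK.below-char u)) (==-∧ (MK.m ≺_) MH.m u))

    -- The leader of v's K-component is a G-leader only if it lies in P or the
    -- H-component of v reaches below it.
    K-count : components Q EK ≡ ind (P MK.m ∨ (MH.m ≺ MK.m)) +ₙ offP
    K-count = trans (countB-split (leader Q EK) (λ u → P u ∨ (K.C v u ∧ OffP.K-below u)))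
                    (cong (_+ₙ offP) (countB-point _ MK.m (P MK.m ∨ (MH.m ≺ MK.m)) at-mK))
      where
      absorb : ∀ l p c b → (l ≡ true → p ≡ true → c ≡ true) → (l ∧ (p ∨ (c ∧ b))) ≡ ((l ∧ c) ∧ (p ∨ b))
      absorb false p c b h = refl
      absorb true true true b h = refl
      absorb true true false b h = ⊥-elim (true-and-false (h refl refl) refl)
      absorb true false c b h = refl
      P-reaches : ∀ u → leader Q EK u ≡ true → P u ≡ true → K.C v u ≡ true
      P-reaches u lead Pu with P∩Q⊆v u Pu (∧-trueˡ lead)
      ... | refl = K.C-refl Qv
      at-mK : ∀ u → (leader Q EK u ∧ (P u ∨ (K.C v u ∧ OffP.K-below u))) ≡ ((u ==ᶠ MK.m) ∧ (P MK.m ∨ (MH.m ≺ MK.m)))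
      at-mK u = trans (cong (λ b → leader Q EK u ∧ (P u ∨ (K.C v u ∧ b))) (MH.below-char u))
                (trans (absorb (leader Q EK u) (P u) (K.C v u) (MH.m ≺ u) (P-reaches u))
                (trans (cong (_∧ (P u ∨ (MH.m ≺ u))) (MK.leader-char u)) (==-∧ (λ y → P y ∨ (MH.m ≺ y)) MK.m u)))

    -- mK ∈ P would force mK = v, but mH lies below v.
    mK∉P : toℕ MK.m < toℕ MH.m → P MK.m ≡ false
    mK∉P mK<mH = ¬true⇒false (λ p → ℕP.<-irrefl refl
      (ℕP.<-≤-trans mK<mH (subst (λ y → toℕ MH.m ≤ toℕ y) (sym (P∩Q⊆v MK.m p MK.Ym)) MH.m≤v)))

    -- Exactly one of the two leaders survives.
    one-survives : ind (MK.m ≺ MH.m) +ₙ ind (P MK.m ∨ (MH.m ≺ MK.m)) ≡ 1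
    one-survives with ℕP.<-cmp (toℕ MH.m) (toℕ MK.m)
    ... | tri< mH<mK _ mK≮mH
      rewrite ≮⇒≺false {w = MK.m} {u = MH.m} mK≮mH | <⇒≺ {w = MH.m} {u = MK.m} mH<mK | BP.∨-zeroʳ (P MK.m) = refl
    ... | tri≈ mH≮mK mH≡mK mK≮mH
      rewrite ≮⇒≺false {w = MK.m} {u = MH.m} mK≮mH | ≮⇒≺false {w = MH.m} {u = MK.m} mH≮mK
            | sym (FP.toℕ-injective mH≡mK) | MH.Ym = refl
    ... | tri> _ mH≢mK mK<mH
      rewrite <⇒≺ {w = MK.m} {u = MH.m} mK<mH | ≮⇒≺false {w = MH.m} {u = MK.m} (ℕP.<-asym mK<mH)
            | mK∉P mK<mH = refl

    glue-shared : components X EG +ₙ 1 ≡ components P EH +ₙ components Q EK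
    glue-shared = begin
      components X EG +ₙ 1                           ≡⟨ cong₂ _+ₙ_ components-split (sym one-survives) ⟩
      (onP +ₙ offP) +ₙ (ind (MK.m ≺ MH.m) +ₙ ind (P MK.m ∨ (MH.m ≺ MK.m)))
                                                     ≡⟨ rearrange onP offP (ind (MK.m ≺ MH.m)) (ind (P MK.m ∨ (MH.m ≺ MK.m))) ⟩
      (ind (MK.m ≺ MH.m) +ₙ onP) +ₙ (ind (P MK.m ∨ (MH.m ≺ MK.m)) +ₙ offP)
                                                     ≡⟨ sym (cong₂ _+ₙ_ H-count K-count) ⟩
      components P EH +ₙ components Q EK             ∎
      where
      open ≡-Reasoning
      rearrange : ∀ a b c d → (a +ₙ b) +ₙ (c +ₙ d) ≡ (c +ₙ a) +ₙ (d +ₙ b)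
      rearrange = ℕsolve-∀

Sub : ℕ → Set
Sub n = Fin n → Bool

ΣSub : ∀ {n} → (Sub n → ℤ) → ℤ
ΣSub {n} F = sumℤ (map F (subsets n))

_∩_ : ∀ {n} → Sub n → Sub n → Sub n
(X ∩ Y) u = X u ∧ Y u

complement : ∀ {n} → Sub n → Sub n
complement Y u = not (Y u)

insert : ∀ {n} → Fin n → Sub n → Sub n
insert v X u = X u ∨ (u ==ᶠ v)

Ext : ∀ {n} → (Sub n → ℤ) → Set
Ext {n} F = ∀ X Y → (∀ u → X u ≡ Y u) → F X ≡ F Y

SupportedIn : ∀ {n} → Sub n → (Sub n → ℤ) → Set
SupportedIn s a = ∀ A u → A u ≡ true → s u ≡ false → a A ≡ ℤ.0ℤ

module _ {A : Set} where
  sumℤ-map-+ : (f g : A → ℤ) (xs : List A) →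
               sumℤ (map (λ x → f x + g x) xs) ≡ sumℤ (map f xs) + sumℤ (map g xs)
  sumℤ-map-+ f g [] = refl
  sumℤ-map-+ f g (x ∷ xs) rewrite sumℤ-map-+ f g xs = interchange (f x) (g x) (sumℤ (map f xs)) (sumℤ (map g xs))
    where
    interchange : ∀ a b c d → (a + b) + (c + d) ≡ (a + c) + (b + d)
    interchange = solve-∀

  sumℤ-map-* : (c : ℤ) (f : A → ℤ) (xs : List A) → sumℤ (map (λ x → c * f x) xs) ≡ c * sumℤ (map f xs)
  sumℤ-map-* c f [] = sym (ℤP.*-zeroʳ c)
  sumℤ-map-* c f (x ∷ xs) rewrite sumℤ-map-* c f xs = sym (ℤP.*-distribˡ-+ c (f x) _)

  sumℤ-map-zero : (f : A → ℤ) (xs : List A) → (∀ x → f x ≡ ℤ.0ℤ) → sumℤ (map f xs) ≡ ℤ.0ℤ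
  sumℤ-map-zero f [] h = refl
  sumℤ-map-zero f (x ∷ xs) h rewrite h x | sumℤ-map-zero f xs h = refl

sumℤ-++ : ∀ xs ys → sumℤ (xs ++ ys) ≡ sumℤ xs + sumℤ ys
sumℤ-++ [] ys = sym (ℤP.+-identityˡ _)
sumℤ-++ (x ∷ xs) ys rewrite sumℤ-++ xs ys = sym (ℤP.+-assoc x _ _)

ΣSub-cong : ∀ {n} {F G : Sub n → ℤ} → (∀ X → F X ≡ G X) → ΣSub F ≡ ΣSub G
ΣSub-cong {n} h = cong sumℤ (LP.map-cong h (subsets n))

ΣSub-+ : ∀ {n} (F G : Sub n → ℤ) → ΣSub (λ X → F X + G X) ≡ ΣSub F + ΣSub G
ΣSub-+ {n} F G = sumℤ-map-+ F G (subsets n)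

ΣSub-* : ∀ {n} (c : ℤ) (F : Sub n → ℤ) → ΣSub (λ X → c * F X) ≡ c * ΣSub F
ΣSub-* {n} c F = sumℤ-map-* c F (subsets n)

ΣSub-zero : ∀ {n} (F : Sub n → ℤ) → (∀ X → F X ≡ ℤ.0ℤ) → ΣSub F ≡ ℤ.0ℤ
ΣSub-zero {n} F = sumℤ-map-zero F (subsets n)

ΣSub-suc : ∀ {n} (F : Sub (ℕ.suc n) → ℤ) →
           ΣSub F ≡ ΣSub (λ X → F (false ∷ᶠ X)) + ΣSub (λ X → F (true ∷ᶠ X))
ΣSub-suc {n} F =
  begin
    sumℤ (map F (map (false ∷ᶠ_) (subsets n) ++ map (true ∷ᶠ_) (subsets n)))
  ≡⟨ cong sumℤ (LP.map-++ F (map (false ∷ᶠ_) (subsets n)) _) ⟩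
    sumℤ (map F (map (false ∷ᶠ_) (subsets n)) ++ map F (map (true ∷ᶠ_) (subsets n)))
  ≡⟨ sumℤ-++ (map F (map (false ∷ᶠ_) (subsets n))) _ ⟩
    sumℤ (map F (map (false ∷ᶠ_) (subsets n))) + sumℤ (map F (map (true ∷ᶠ_) (subsets n)))
  ≡⟨ sym (cong₂ _+_ (cong sumℤ (LP.map-∘ (subsets n))) (cong sumℤ (LP.map-∘ (subsets n)))) ⟩
    ΣSub (λ X → F (false ∷ᶠ X)) + ΣSub (λ X → F (true ∷ᶠ X))
  ∎
  where open ≡-Reasoning

Ext-cons : ∀ {n} {F : Sub (ℕ.suc n) → ℤ} → Ext F → ∀ c → Ext (λ X → F (c ∷ᶠ X))
Ext-cons eF c X Y h = eF _ _ (λ { zero → refl ; (suc u) → h u })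

SupportedIn-cons : ∀ {n} {s : Sub (ℕ.suc n)} {a : Sub (ℕ.suc n) → ℤ} →
                   SupportedIn s a → ∀ c → SupportedIn (λ u → s (suc u)) (λ X → a (c ∷ᶠ X))
SupportedIn-cons va c A u = va _ (suc u)

ΣSub-split : ∀ {n} (F : Sub n → ℤ) (v : Fin n) →
  ΣSub F ≡ ΣSub (λ X → if X v then F X else ℤ.0ℤ) + ΣSub (λ X → if X v then ℤ.0ℤ else F X)
ΣSub-split F v = trans (ΣSub-cong by-v) (ΣSub-+ (λ X → if X v then F X else ℤ.0ℤ) (λ X → if X v then ℤ.0ℤ else F X))
  where
  by-v : ∀ X → F X ≡ (if X v then F X else ℤ.0ℤ) + (if X v then ℤ.0ℤ else F X)
  by-v X with X v
  ... | true = sym (ℤP.+-identityʳ (F X))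
  ... | false = sym (ℤP.+-identityˡ (F X))

-- The product formula: if a is supported in s and b in its complement, then summing
-- a(X ∩ s)·b(X ∖ s) over all X gives (Σ a)(Σ b), since X ↦ (X ∩ s, X ∖ s) pairs the
-- subsets of Fin n with the pairs (A ⊆ s, B ⊆ complement s).
ProductFormula : ℕ → Set
ProductFormula n = ∀ (s : Sub n) (a b : Sub n → ℤ) → Ext a → Ext b →
  SupportedIn s a → SupportedIn (complement s) b →
  ΣSub (λ X → a (X ∩ s) * b (X ∩ complement s)) ≡ ΣSub a * ΣSub b

product-step : ∀ {n} → ProductFormula n → (s : Sub (ℕ.suc n)) (a b : Sub (ℕ.suc n) → ℤ) →
  Ext a → Ext b → SupportedIn s a → SupportedIn (complement s) b → s zero ≡ true →
  ΣSub (λ X → a (X ∩ s) * b (X ∩ complement s)) ≡ ΣSub a * ΣSub b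
product-step {n} IH s a b ea eb va vb s0 =
  begin
    ΣSub (λ X → a (X ∩ s) * b (X ∩ complement s))
  ≡⟨ ΣSub-suc (λ X → a (X ∩ s) * b (X ∩ complement s)) ⟩
    ΣSub (λ X → a ((false ∷ᶠ X) ∩ s) * b ((false ∷ᶠ X) ∩ complement s))
      + ΣSub (λ X → a ((true ∷ᶠ X) ∩ s) * b ((true ∷ᶠ X) ∩ complement s))
  ≡⟨ cong₂ _+_ (ΣSub-cong (λ X → cong₂ _*_ (ea _ _ (without-zero X s)) (eb _ _ (without-zero X (complement s)))))
               (ΣSub-cong (λ X → cong₂ _*_ (ea _ _ (with-zero X)) (eb _ _ (with-zero′ X)))) ⟩
    ΣSub (λ X → a₀ (X ∩ s′) * b₀ (X ∩ complement s′)) + ΣSub (λ X → a₁ (X ∩ s′) * b₀ (X ∩ complement s′))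
  ≡⟨ cong₂ _+_ (IH s′ a₀ b₀ (Ext-cons ea false) (Ext-cons eb false) (SupportedIn-cons va false) (SupportedIn-cons vb false))
               (IH s′ a₁ b₀ (Ext-cons ea true) (Ext-cons eb false) (SupportedIn-cons va true) (SupportedIn-cons vb false)) ⟩
    ΣSub a₀ * ΣSub b₀ + ΣSub a₁ * ΣSub b₀
  ≡⟨ factor (ΣSub a₀) (ΣSub a₁) (ΣSub b₀) ⟩
    (ΣSub a₀ + ΣSub a₁) * (ΣSub b₀ + ℤ.0ℤ)
  ≡⟨ sym (cong₂ _*_ (ΣSub-suc a) (trans (ΣSub-suc b) (cong (ΣSub b₀ +_) b₁-vanishes))) ⟩
    ΣSub a * ΣSub b
  ∎
  where
  open ≡-Reasoning
  s′ : Sub n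
  s′ u = s (suc u)
  a₀ a₁ b₀ : Sub n → ℤ
  a₀ X = a (false ∷ᶠ X)
  a₁ X = a (true ∷ᶠ X)
  b₀ X = b (false ∷ᶠ X)
  -- every set containing zero meets s, so b vanishes on it
  b₁-vanishes : ΣSub (λ X → b (true ∷ᶠ X)) ≡ ℤ.0ℤ
  b₁-vanishes = ΣSub-zero (λ X → b (true ∷ᶠ X)) (λ X → vb (true ∷ᶠ X) zero refl (cong not s0))
  without-zero : ∀ X (Y : Sub (ℕ.suc n)) u → ((false ∷ᶠ X) ∩ Y) u ≡ (false ∷ᶠ (X ∩ (λ i → Y (suc i)))) u
  without-zero X Y zero = refl
  without-zero X Y (suc u) = refl
  with-zero : ∀ X u → ((true ∷ᶠ X) ∩ s) u ≡ (true ∷ᶠ (X ∩ s′)) u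
  with-zero X zero = s0
  with-zero X (suc u) = refl
  with-zero′ : ∀ X u → ((true ∷ᶠ X) ∩ complement s) u ≡ (false ∷ᶠ (X ∩ complement s′)) u
  with-zero′ X zero = cong not s0
  with-zero′ X (suc u) = refl
  factor : ∀ p q r → p * r + q * r ≡ (p + q) * (r + ℤ.0ℤ)
  factor = solve-∀

product : ∀ {n} → ProductFormula n
product {ℕ.zero} s a b ea eb va vb =
  trans (cong₂ (λ p q → p * q + ℤ.0ℤ) (ea _ _ (λ ())) (eb _ _ (λ ()))) (only-empty (a (λ ())) (b (λ ())))
  where
  only-empty : ∀ p q → p * q + ℤ.0ℤ ≡ (p + ℤ.0ℤ) * (q + ℤ.0ℤ)
  only-empty = solve-∀
product {ℕ.suc n} s a b ea eb va vb = by-zero (s zero) refl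
  where
  by-zero : (c : Bool) → s zero ≡ c → ΣSub (λ X → a (X ∩ s) * b (X ∩ complement s)) ≡ ΣSub a * ΣSub b
  by-zero true s0 = product-step product s a b ea eb va vb s0
  -- otherwise zero lies in the complement of s: exchange the roles of a and b
  by-zero false s0 =
    trans (ΣSub-cong exchange)
          (trans (product-step product (complement s) b a eb ea vb va′ (cong not s0)) (ℤP.*-comm (ΣSub b) (ΣSub a)))
    where
    va′ : SupportedIn (complement (complement s)) a
    va′ A u Au ns = va A u Au (trans (sym (BP.not-involutive (s u))) ns)
    exchange : ∀ X → a (X ∩ s) * b (X ∩ complement s) ≡ b (X ∩ complement s) * a (X ∩ complement (complement s))
    exchange X = trans (ℤP.*-comm (a (X ∩ s)) _)
                       (cong (b (X ∩ complement s) *_) (ea _ _ (λ u → cong (X u ∧_) (sym (BP.not-involutive (s u))))))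

ΣSub-containing : ∀ {n} (v : Fin n) (F : Sub n → ℤ) → Ext F →
  ΣSub (λ X → if X v then F X else ℤ.0ℤ) ≡ ΣSub (λ X → if X v then ℤ.0ℤ else F (insert v X))
ΣSub-containing {ℕ.suc n} zero F eF = trans containing (sym avoiding)
  where
  nothing : ΣSub {n} (λ _ → ℤ.0ℤ) ≡ ℤ.0ℤ
  nothing = ΣSub-zero {n} (λ _ → ℤ.0ℤ) (λ _ → refl)
  containing : ΣSub (λ X → if X zero then F X else ℤ.0ℤ) ≡ ΣSub (λ X → F (true ∷ᶠ X))
  containing = trans (ΣSub-suc (λ X → if X zero then F X else ℤ.0ℤ))
                     (trans (cong (_+ ΣSub (λ X → F (true ∷ᶠ X))) nothing) (ℤP.+-identityˡ _))
  inserted : ∀ X u → insert zero (false ∷ᶠ X) u ≡ (true ∷ᶠ X) u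
  inserted X zero = refl
  inserted X (suc u) = BP.∨-identityʳ (X u)
  avoiding : ΣSub (λ X → if X zero then ℤ.0ℤ else F (insert zero X)) ≡ ΣSub (λ X → F (true ∷ᶠ X))
  avoiding = trans (ΣSub-suc (λ X → if X zero then ℤ.0ℤ else F (insert zero X)))
                   (trans (cong₂ _+_ (ΣSub-cong (λ X → eF _ _ (inserted X))) nothing) (ℤP.+-identityʳ _))
ΣSub-containing {ℕ.suc n} (suc v) F eF =
  trans (ΣSub-suc (λ X → if X (suc v) then F X else ℤ.0ℤ))
        (trans (cong₂ _+_ (ΣSub-containing v _ (Ext-cons eF false)) (ΣSub-containing v _ (Ext-cons eF true)))
        (sym (trans (ΣSub-suc (λ X → if X (suc v) then ℤ.0ℤ else F (insert (suc v) X)))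
                    (cong₂ _+_ (ΣSub-cong (commute false)) (ΣSub-cong (commute true))))))
  where
  commute : ∀ c X → (if X v then ℤ.0ℤ else F (insert (suc v) (c ∷ᶠ X)))
                  ≡ (if X v then ℤ.0ℤ else F (c ∷ᶠ insert v X))
  commute c X = cong (if X v then ℤ.0ℤ else_) (eF _ _ pointwise)
    where
    pointwise : ∀ u → insert (suc v) (c ∷ᶠ X) u ≡ (c ∷ᶠ insert v X) u
    pointwise zero = BP.∨-identityʳ c
    pointwise (suc u) = cong (X u ∨_) (==-suc u v)

_⊆ᵇ_ : ∀ {n} → Sub n → Sub n → Bool
_⊆ᵇ_ {n} X W = all (λ u → not (X u) ∨ W u) (allFin n)

monomial : ℤ → ℤ → ℕ → ℕ → ℤ
monomial x y a c = x ℤ.^ a * y ℤ.^ c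

term : ∀ {n} → Graph n → ℤ → ℤ → Sub n → ℤ
term G x y X = if X ⊆ᵇ V G then monomial x y (countB X) (components X (E G)) else ℤ.0ℤ

Q≡ΣSub : ∀ {n} (G : Graph n) x y → Q G x y ≡ ΣSub (term G x y)
Q≡ΣSub G x y = refl

⊆ᵇ-intro : ∀ {n} (X W : Sub n) → (∀ u → X u ≡ true → W u ≡ true) → (X ⊆ᵇ W) ≡ true
⊆ᵇ-intro {n} X W h = all-intro _ (allFin n) pointwise
  where
  pointwise : ∀ u → (not (X u) ∨ W u) ≡ true
  pointwise u with X u in Xu
  ... | true = h u Xu
  ... | false = refl

⊆ᵇ-elim : ∀ {n} (X W : Sub n) → (X ⊆ᵇ W) ≡ true → ∀ u → X u ≡ true → W u ≡ true
⊆ᵇ-elim X W X⊆W u Xu with all-elim (λ u → not (X u) ∨ W u) X⊆W (∈-allFin u)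
... | h rewrite Xu = h

⊆ᵇ-false : ∀ {n} (X W : Sub n) u → X u ≡ true → W u ≡ false → (X ⊆ᵇ W) ≡ false
⊆ᵇ-false X W u Xu Wu = ¬true⇒false (λ X⊆W → true-and-false (⊆ᵇ-elim X W X⊆W u Xu) Wu)

⊆ᵇ-witness : ∀ {n} (X W : Sub n) → (X ⊆ᵇ W) ≡ false → Σ (Fin n) λ u → X u ≡ true × W u ≡ false
⊆ᵇ-witness {n} X W X⊈W = search (allFin n) X⊈W
  where
  search : (us : List (Fin n)) → all (λ u → not (X u) ∨ W u) us ≡ false → Σ (Fin n) λ u → X u ≡ true × W u ≡ false
  search (u ∷ us) e with X u in Xu | W u in Wu
  ... | true | false = u , Xu , Wu
  ... | true | true = search us e
  ... | false | _ = search us e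

term-outside : ∀ {n} (G : Graph n) x y X → (X ⊆ᵇ V G) ≡ false → term G x y X ≡ ℤ.0ℤ
term-outside G x y X e rewrite e = refl

term-inside : ∀ {n} (G : Graph n) x y X → (X ⊆ᵇ V G) ≡ true →
              term G x y X ≡ monomial x y (countB X) (components X (E G))
term-inside G x y X e rewrite e = refl

term-ext : ∀ {n} (G : Graph n) x y → Ext (term G x y)
term-ext {n} G x y X Y h =
  cong₂ (λ b r → if b then r else ℤ.0ℤ) (all-cong (allFin n) (λ u → cong (λ b → not b ∨ V G u) (h u)))
        (cong₂ (monomial x y) (countB-cong h) (components-cong X Y (E G) (E G) h (λ _ _ _ _ → refl)))

term-delete : ∀ {n} (H : Graph n) (v : Fin n) x y X →
              term (H ─ v) x y X ≡ (if X v then ℤ.0ℤ else term H x y X)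
term-delete {n} H v x y X with X v in Xv
... | true = term-outside (H ─ v) x y X (⊆ᵇ-false X (V (H ─ v)) v Xv v∉H─v)
  where
  v∉H─v : V (H ─ v) v ≡ false
  v∉H─v rewrite ==-refl v = BP.∧-zeroʳ (V H v)
... | false = cong₂ (λ b r → if b then r else ℤ.0ℤ) same-test
                    (cong (monomial x y (countB X)) (components-cong X X (E (H ─ v)) (E H) (λ _ → refl) same-edges))
  where
  away : ∀ u → X u ≡ true → (u ==ᶠ v) ≡ false
  away u Xu = ≢⇒==false (λ { refl → true-and-false Xu Xv })
  same-test : (X ⊆ᵇ V (H ─ v)) ≡ (X ⊆ᵇ V H)
  same-test = ≡-from-⇔ (λ e → ⊆ᵇ-intro X (V H) (λ u Xu → ∧-trueˡ (⊆ᵇ-elim X _ e u Xu)))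
                       (λ e → ⊆ᵇ-intro X (V (H ─ v)) (λ u Xu → ∧-true (⊆ᵇ-elim X _ e u Xu) (cong not (away u Xu))))
  same-edges : ∀ z w → X z ≡ true → X w ≡ true → E (H ─ v) z w ≡ E H z w
  same-edges z w Xz Xw rewrite away z Xz | away w Xw = BP.∧-identityʳ (E H z w)

Q-difference : ∀ {n} (H : Graph n) (v : Fin n) x y →
               Q H x y - Q (H ─ v) x y ≡ ΣSub (λ X → if X v then term H x y X else ℤ.0ℤ)
Q-difference H v x y =
  trans (cong₂ _-_ (ΣSub-split (term H x y) v) (ΣSub-cong (term-delete H v x y))) (cancel _ _)
  where
  cancel : ∀ a b → (a + b) - b ≡ a
  cancel = solve-∀

monomial-* : ∀ x y a c b d → monomial x y a c * monomial x y b d ≡ monomial x y (a +ₙ b) (c +ₙ d)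
monomial-* x y a c b d rewrite ℤP.^-distribˡ-+-* x a b | ℤP.^-distribˡ-+-* y c d = regroup (x ℤ.^ a) (y ℤ.^ c) _ _
  where
  regroup : ∀ p q r s → (p * q) * (r * s) ≡ (p * r) * (q * s)
  regroup = solve-∀

monomial-weigh : ∀ x y (b : Bool) a c → (x * y) ℤ.^ ind b * monomial x y a c ≡ monomial x y (a +ₙ ind b) (c +ₙ ind b)
monomial-weigh x y false a c rewrite ℕP.+-identityʳ a | ℕP.+-identityʳ c = ℤP.*-identityˡ _
monomial-weigh x y true a c rewrite ℕP.+-comm a 1 | ℕP.+-comm c 1 = regroup x y (x ℤ.^ a) (y ℤ.^ c)
  where
  regroup : ∀ x y p q → (x * y * ℤ.1ℤ) * (p * q) ≡ (x * p) * (y * q)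
  regroup = solve-∀

module CutVertex {n : ℕ} (G H K : Graph n) (v : Fin n)
  (sH : IsSimpleGraph H) (sK : IsSimpleGraph K)
  (U : IsUnion G H K) (I : IsIntersectionSingleVertex H K v) where
  open IsUnion U
  open IsIntersectionSingleVertex I

  v∈H : V H v ≡ true
  v∈H = ∧-trueˡ (trans (V∩ v) (==-refl v))

  v∈K : V K v ≡ true
  v∈K = ∧-trueʳ {V H v} (trans (V∩ v) (==-refl v))

  edge-in-H : ∀ z w → E H z w ≡ true → V H w ≡ true
  edge-in-H z w e = IsSimpleGraph.E-V sH w z (trans (IsSimpleGraph.E-sym sH w z) e)

  edge-in-K : ∀ z w → E K z w ≡ true → V K w ≡ true
  edge-in-K z w e = IsSimpleGraph.E-V sK w z (trans (IsSimpleGraph.E-sym sK w z) e)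

  G∖H⊆K : ∀ {u} → V G u ≡ true → V H u ≡ false → V K u ≡ true
  G∖H⊆K {u} Gu Hu = subst (λ b → (b ∨ V K u) ≡ true) Hu (trans (sym (V∪ u)) Gu)

  gluing : (Y : Sub n) → (Y ⊆ᵇ V G) ≡ true → Gluing Y (Y ∩ V H) (Y ∩ V K) (E G) (E H) (E K) v
  gluing Y Y⊆G = record
    { X≡P∪Q = covered
    ; P∩Q⊆v = λ z p q → ==⇒≡ (trans (sym (V∩ z)) (∧-true (∧-trueʳ {Y z} p) (∧-trueʳ {Y z} q)))
    ; EG≡ = E∪
    ; EH-in-P = λ z w _ Yw e → ∧-true Yw (edge-in-H z w e)
    ; EK-in-Q = λ z w _ Yw e → ∧-true Yw (edge-in-K z w e)
    ; EH-sym = IsSimpleGraph.E-sym sH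
    ; EK-sym = IsSimpleGraph.E-sym sK }
    where
    covered : ∀ z → Y z ≡ ((Y ∩ V H) z ∨ (Y ∩ V K) z)
    covered z with Y z in Yz
    ... | true = sym (trans (sym (V∪ z)) (⊆ᵇ-elim Y (V G) Y⊆G z Yz))
    ... | false = refl

  glue-counts : ∀ Y → (Y ⊆ᵇ V G) ≡ true → countB Y +ₙ ind (Y v) ≡ countB (Y ∩ V H) +ₙ countB (Y ∩ V K)
  glue-counts Y Y⊆G =
    begin
      countB Y +ₙ ind (Y v)
    ≡⟨ cong₂ _+ₙ_ (trans (countB-split Y (V H)) (cong (countB (Y ∩ V H) +ₙ_) (countB-cong only-K)))
                  (sym (countB-point _ v (Y v) shared)) ⟩
      (countB (Y ∩ V H) +ₙ countB (λ u → (Y ∩ V K) u ∧ not (V H u))) +ₙ countB (λ u → (Y ∩ V K) u ∧ V H u)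
    ≡⟨ regroup (countB (Y ∩ V H)) _ _ ⟩
      countB (Y ∩ V H) +ₙ (countB (λ u → (Y ∩ V K) u ∧ V H u) +ₙ countB (λ u → (Y ∩ V K) u ∧ not (V H u)))
    ≡⟨ cong (countB (Y ∩ V H) +ₙ_) (sym (countB-split (Y ∩ V K) (V H))) ⟩
      countB (Y ∩ V H) +ₙ countB (Y ∩ V K)
    ∎
    where
    open ≡-Reasoning
    regroup : ∀ a b c → (a +ₙ b) +ₙ c ≡ a +ₙ (c +ₙ b)
    regroup = ℕsolve-∀
    shared : ∀ u → ((Y ∩ V K) u ∧ V H u) ≡ ((u ==ᶠ v) ∧ Y v)
    shared u = begin
      (Y u ∧ V K u) ∧ V H u   ≡⟨ BP.∧-assoc (Y u) _ _ ⟩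
      Y u ∧ (V K u ∧ V H u)   ≡⟨ cong (Y u ∧_) (trans (BP.∧-comm (V K u) _) (V∩ u)) ⟩
      Y u ∧ (u ==ᶠ v)         ≡⟨ BP.∧-comm (Y u) _ ⟩
      (u ==ᶠ v) ∧ Y u         ≡⟨ ==-∧ Y v u ⟩
      (u ==ᶠ v) ∧ Y v         ∎
    only-K : ∀ u → (Y u ∧ not (V H u)) ≡ ((Y ∩ V K) u ∧ not (V H u))
    only-K u with Y u in Yu | V H u in Hu
    ... | false | _ = refl
    ... | true | true = sym (BP.∧-zeroʳ (V K u))
    ... | true | false = sym (trans (BP.∧-identityʳ (V K u)) (G∖H⊆K (⊆ᵇ-elim Y (V G) Y⊆G u Yu) Hu))

  glue-components : ∀ Y → (Y ⊆ᵇ V G) ≡ true →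
    components Y (E G) +ₙ ind (Y v) ≡ components (Y ∩ V H) (E H) +ₙ components (Y ∩ V K) (E K)
  glue-components Y Y⊆G with Y v in Yv
  ... | false = trans (ℕP.+-identityʳ _) (glue-disjoint (cong (_∧ V H v) Yv) (cong (_∧ V K v) Yv))
    where open GluedComponents (gluing Y Y⊆G)
  ... | true = glue-shared
    where open GluedComponents.Shared (gluing Y Y⊆G) (∧-true Yv v∈H) (∧-true Yv v∈K)

  glued-term : ∀ x y Y → (Y ⊆ᵇ V G) ≡ true →
    (x * y) ℤ.^ ind (Y v) * term G x y Y ≡ term H x y (Y ∩ V H) * term K x y (Y ∩ V K)
  glued-term x y Y Y⊆G =
    begin
      (x * y) ℤ.^ ind (Y v) * term G x y Y
    ≡⟨ cong ((x * y) ℤ.^ ind (Y v) *_) (term-inside G x y Y Y⊆G) ⟩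
      (x * y) ℤ.^ ind (Y v) * monomial x y (countB Y) (components Y (E G))
    ≡⟨ monomial-weigh x y (Y v) (countB Y) (components Y (E G)) ⟩
      monomial x y (countB Y +ₙ ind (Y v)) (components Y (E G) +ₙ ind (Y v))
    ≡⟨ cong₂ (monomial x y) (glue-counts Y Y⊆G) (glue-components Y Y⊆G) ⟩
      monomial x y (countB (Y ∩ V H) +ₙ countB (Y ∩ V K))
                   (components (Y ∩ V H) (E H) +ₙ components (Y ∩ V K) (E K))
    ≡⟨ sym (monomial-* x y (countB (Y ∩ V H)) (components (Y ∩ V H) (E H)) (countB (Y ∩ V K)) (components (Y ∩ V K) (E K))) ⟩
      monomial x y (countB (Y ∩ V H)) (components (Y ∩ V H) (E H))
        * monomial x y (countB (Y ∩ V K)) (components (Y ∩ V K) (E K))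
    ≡⟨ sym (cong₂ _*_ (term-inside H x y (Y ∩ V H) (⊆ᵇ-intro _ _ (λ u → ∧-trueʳ {Y u})))
                      (term-inside K x y (Y ∩ V K) (⊆ᵇ-intro _ _ (λ u → ∧-trueʳ {Y u})))) ⟩
      term H x y (Y ∩ V H) * term K x y (Y ∩ V K)
    ∎
    where open ≡-Reasoning

  H⊆G : ∀ {u} → V H u ≡ true → V G u ≡ true
  H⊆G {u} Hu = trans (V∪ u) (∨-trueˡ Hu)

  K⊆G : ∀ {u} → V K u ≡ true → V G u ≡ true
  K⊆G {u} Ku = trans (V∪ u) (∨-trueʳ {V H u} Ku)

  -- The sums are split by s = V(H − v), the vertices of H other than v;
  -- its complement holds the vertices of K other than v (and those outside G).
  s : Sub n
  s = V (H ─ v)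

  v-deleted : ∀ (H′ : Graph n) → V (H′ ─ v) v ≡ false
  v-deleted H′ rewrite ==-refl v = BP.∧-zeroʳ (V H′ v)

  v∉s : s v ≡ false
  v∉s = v-deleted H

  s-away : ∀ {u} → (u ==ᶠ v) ≡ false → s u ≡ V H u
  s-away {u} e rewrite e = BP.∧-identityʳ (V H u)

  s⇒¬K : ∀ {u} → s u ≡ true → V K u ≡ false
  s⇒¬K {u} su = ¬true⇒false (λ Ku →
    true-and-false (trans (sym (V∩ u)) (∧-true (∧-trueˡ su) Ku)) (not-true⇒false (∧-trueʳ {V H u} su)))

  ¬s⇒K : ∀ {u} → V G u ≡ true → (u ==ᶠ v) ≡ false → not (s u) ≡ V K u
  ¬s⇒K {u} Gu e rewrite s-away e with V H u in Hu
  ... | false = sym (G∖H⊆K Gu Hu)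
  ... | true = sym (¬true⇒false (λ Ku → true-and-false (trans (sym (V∩ u)) (∧-true Hu Ku)) e))

  away-from-v : ∀ {X : Sub n} {u} → X v ≡ false → X u ≡ true → (u ==ᶠ v) ≡ false
  away-from-v Xv Xu = ≢⇒==false (λ { refl → true-and-false Xu Xv })

  at-v-or-away : ∀ u → (u ≡ v) ⊎ ((u ==ᶠ v) ≡ false)
  at-v-or-away u with u ==ᶠ v in e
  ... | true = inj₁ (==⇒≡ e)
  ... | false = inj₂ refl

  insert-at : ∀ X → insert v X v ≡ true
  insert-at X = ∨-trueʳ {X v} (==-refl v)

  insert-away : ∀ X {u} → (u ==ᶠ v) ≡ false → insert v X u ≡ X u
  insert-away X {u} e rewrite e = BP.∨-identityʳ (X u)

  H-away : ∀ b {u} → (u ==ᶠ v) ≡ false → (b ∧ s u) ≡ (b ∧ V H u)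
  H-away b e = cong (b ∧_) (s-away e)

  K-away : ∀ b {u} → (u ==ᶠ v) ≡ false → (b ≡ true → V G u ≡ true) → (b ∧ not (s u)) ≡ (b ∧ V K u)
  K-away true e Gu = ¬s⇒K (Gu refl) e
  K-away false e Gu = refl

  H-part : ∀ X → X v ≡ false → ∀ u → (X ∩ s) u ≡ (X ∩ V H) u
  H-part X Xv u with at-v-or-away u
  ... | inj₁ refl rewrite Xv = refl
  ... | inj₂ e = H-away (X u) e

  K-part : ∀ X → X v ≡ false → (X ⊆ᵇ V G) ≡ true → ∀ u → (X ∩ complement s) u ≡ (X ∩ V K) u
  K-part X Xv X⊆G u with at-v-or-away u
  ... | inj₁ refl rewrite Xv = refl
  ... | inj₂ e = K-away (X u) e (⊆ᵇ-elim X (V G) X⊆G u)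

  H-part-insert : ∀ X u → insert v (X ∩ s) u ≡ (insert v X ∩ V H) u
  H-part-insert X u with at-v-or-away u
  ... | inj₁ refl = trans (insert-at (X ∩ s)) (sym (∧-true (insert-at X) v∈H))
  ... | inj₂ e = trans (insert-away (X ∩ s) e) (trans (H-away (X u) e) (cong (_∧ V H u) (sym (insert-away X e))))

  K-part-insert : ∀ X → (insert v X ⊆ᵇ V G) ≡ true → ∀ u → insert v (X ∩ complement s) u ≡ (insert v X ∩ V K) u
  K-part-insert X X⊆G u with at-v-or-away u
  ... | inj₁ refl = trans (insert-at (X ∩ complement s)) (sym (∧-true (insert-at X) v∈K))
  ... | inj₂ e = trans (insert-away (X ∩ complement s) e)
                 (trans (K-away (X u) e (λ Xu → ⊆ᵇ-elim (insert v X) (V G) X⊆G u (∨-trueˡ Xu)))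
                        (cong (_∧ V K u) (sym (insert-away X e))))

  module Halves (x y : ℤ) where

    outside-G : ∀ (Z : Sub n) {u} → Z u ≡ true → V G u ≡ false → (Z ∩ complement s) u ≡ true × V K u ≡ false
    outside-G Z {u} Zu Gu =
      ∧-true Zu (cong not (¬true⇒false (λ su → true-and-false (H⊆G (∧-trueˡ su)) Gu))) ,
      ¬true⇒false (λ Ku → true-and-false (K⊆G Ku) Gu)

    avoiding-glued : ∀ X → X v ≡ false → (X ⊆ᵇ V G) ≡ true →
      term (H ─ v) x y (X ∩ s) * term (K ─ v) x y (X ∩ complement s) ≡ term G x y X
    avoiding-glued X Xv X⊆G =
      begin
        term (H ─ v) x y (X ∩ s) * term (K ─ v) x y (X ∩ complement s)
      ≡⟨ cong₂ _*_ (trans (term-delete H v x y (X ∩ s)) (cong (λ b → if b ∧ s v then ℤ.0ℤ else term H x y (X ∩ s)) Xv))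
                   (trans (term-delete K v x y _) (cong (λ b → if b ∧ not (s v) then ℤ.0ℤ else term K x y (X ∩ complement s)) Xv)) ⟩
        term H x y (X ∩ s) * term K x y (X ∩ complement s)
      ≡⟨ cong₂ _*_ (term-ext H x y _ _ (H-part X Xv)) (term-ext K x y _ _ (K-part X Xv X⊆G)) ⟩
        term H x y (X ∩ V H) * term K x y (X ∩ V K)
      ≡⟨ sym (glued-term x y X X⊆G) ⟩
        (x * y) ℤ.^ ind (X v) * term G x y X
      ≡⟨ cong (λ b → (x * y) ℤ.^ ind b * term G x y X) Xv ⟩
        ℤ.1ℤ * term G x y X
      ≡⟨ ℤP.*-identityˡ _ ⟩
        term G x y X
      ∎
      where open ≡-Reasoning

    avoiding-summand : ∀ X → term (H ─ v) x y (X ∩ s) * term (K ─ v) x y (X ∩ complement s)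
                             ≡ (if X v then ℤ.0ℤ else term G x y X)
    avoiding-summand X = by-v (X v) refl
      where
      K-factor-zero : term (K ─ v) x y (X ∩ complement s) ≡ ℤ.0ℤ →
                      term (H ─ v) x y (X ∩ s) * term (K ─ v) x y (X ∩ complement s) ≡ ℤ.0ℤ
      K-factor-zero e = trans (cong (term (H ─ v) x y (X ∩ s) *_) e) (ℤP.*-zeroʳ (term (H ─ v) x y (X ∩ s)))
      by-v : (b : Bool) → X v ≡ b → term (H ─ v) x y (X ∩ s) * term (K ─ v) x y (X ∩ complement s)
                                    ≡ (if b then ℤ.0ℤ else term G x y X)
      by-v true Xv = K-factor-zero (term-outside (K ─ v) x y _
        (⊆ᵇ-false _ (V (K ─ v)) v (∧-true Xv (cong not v∉s)) (v-deleted K)))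
      by-v false Xv = by-subset (X ⊆ᵇ V G) refl
        where
        by-subset : (c : Bool) → (X ⊆ᵇ V G) ≡ c →
                    term (H ─ v) x y (X ∩ s) * term (K ─ v) x y (X ∩ complement s) ≡ term G x y X
        by-subset true X⊆G = avoiding-glued X Xv X⊆G
        by-subset false X⊈G with ⊆ᵇ-witness X (V G) X⊈G
        ... | u , Xu , Gu = trans (K-factor-zero (term-outside (K ─ v) x y _
                              (⊆ᵇ-false _ (V (K ─ v)) u (proj₁ (outside-G X Xu Gu)) (cong (_∧ not (u ==ᶠ v)) (proj₂ (outside-G X Xu Gu))))))
                              (sym (term-outside G x y X X⊈G))

    -- The summand of Q(H′) − Q(H′ − v) at X ∪ {v}, indexed by the subsets X avoiding v.
    lift : Graph n → Sub n → ℤ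
    lift H′ Y = if Y v then ℤ.0ℤ else term H′ x y (insert v Y)

    lift-ext : ∀ H′ → Ext (lift H′)
    lift-ext H′ X Y h = cong₂ (λ b r → if b then ℤ.0ℤ else r) (h v)
                              (term-ext H′ x y _ _ (λ u → cong (_∨ (u ==ᶠ v)) (h u)))

    lift-avoiding : ∀ H′ Y → Y v ≡ false → lift H′ Y ≡ term H′ x y (insert v Y)
    lift-avoiding H′ Y Yv = cong (λ b → if b then ℤ.0ℤ else term H′ x y (insert v Y)) Yv

    containing-glued : ∀ X → X v ≡ false → (insert v X ⊆ᵇ V G) ≡ true →
      x * y * term G x y (insert v X) ≡ lift H (X ∩ s) * lift K (X ∩ complement s)
    containing-glued X Xv X⊆G =
      begin
        x * y * term G x y (insert v X)
      ≡⟨ cong (_* term G x y (insert v X)) (sym (ℤP.*-identityʳ (x * y))) ⟩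
        (x * y) ℤ.^ ind true * term G x y (insert v X)
      ≡⟨ cong (λ b → (x * y) ℤ.^ ind b * term G x y (insert v X)) (sym (insert-at X)) ⟩
        (x * y) ℤ.^ ind (insert v X v) * term G x y (insert v X)
      ≡⟨ glued-term x y (insert v X) X⊆G ⟩
        term H x y (insert v X ∩ V H) * term K x y (insert v X ∩ V K)
      ≡⟨ sym (cong₂ _*_ (trans (lift-avoiding H (X ∩ s) (cong (_∧ s v) Xv)) (term-ext H x y _ _ (H-part-insert X)))
                        (trans (lift-avoiding K (X ∩ complement s) (cong (_∧ not (s v)) Xv)) (term-ext K x y _ _ (K-part-insert X X⊆G)))) ⟩
        lift H (X ∩ s) * lift K (X ∩ complement s)
      ∎
      where open ≡-Reasoning

    containing-summand : ∀ X → x * y * (if X v then ℤ.0ℤ else term G x y (insert v X))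
                               ≡ lift H (X ∩ s) * lift K (X ∩ complement s)
    containing-summand X = by-v (X v) refl
      where
      K-factor-zero : lift K (X ∩ complement s) ≡ ℤ.0ℤ → ℤ.0ℤ ≡ lift H (X ∩ s) * lift K (X ∩ complement s)
      K-factor-zero e = sym (trans (cong (lift H (X ∩ s) *_) e) (ℤP.*-zeroʳ (lift H (X ∩ s))))
      by-v : (b : Bool) → X v ≡ b → x * y * (if b then ℤ.0ℤ else term G x y (insert v X))
                                    ≡ lift H (X ∩ s) * lift K (X ∩ complement s)
      by-v true Xv = trans (ℤP.*-zeroʳ (x * y))
        (K-factor-zero (cong (λ b → if b then ℤ.0ℤ else term K x y (insert v (X ∩ complement s)))
                             (∧-true Xv (cong not v∉s))))
      by-v false Xv = by-subset (insert v X ⊆ᵇ V G) refl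
        where
        by-subset : (c : Bool) → (insert v X ⊆ᵇ V G) ≡ c →
                    x * y * term G x y (insert v X) ≡ lift H (X ∩ s) * lift K (X ∩ complement s)
        by-subset true X⊆G = containing-glued X Xv X⊆G
        by-subset false X⊈G with ⊆ᵇ-witness (insert v X) (V G) X⊈G
        ... | u , Xu , Gu =
          trans (cong (x * y *_) (term-outside G x y (insert v X) X⊈G))
          (trans (ℤP.*-zeroʳ (x * y)) (K-factor-zero (trans (lift-avoiding K (X ∩ complement s) (cong (_∧ not (s v)) Xv)) (term-outside K x y _
            (⊆ᵇ-false _ (V K) u (∨-trueˡ (proj₁ (outside-G X X-at-u Gu))) (proj₂ (outside-G X X-at-u Gu)))))))
          where
          -- u ∉ V(G) is not v, so it lies in X
          X-at-u : X u ≡ true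
          X-at-u = trans (sym (insert-away X (away-from-v {complement (V G)} (cong not (H⊆G v∈H)) (cong not Gu)))) Xu

    avoiding-v : ΣSub (λ X → if X v then ℤ.0ℤ else term G x y X) ≡ Q (H ─ v) x y * Q (K ─ v) x y
    avoiding-v = trans (ΣSub-cong (λ X → sym (avoiding-summand X)))
                       (product s (term (H ─ v) x y) (term (K ─ v) x y) (term-ext _ x y) (term-ext _ x y) in-s off-s)
      where
      in-s : SupportedIn s (term (H ─ v) x y)
      in-s A u Au su = term-outside (H ─ v) x y A (⊆ᵇ-false A s u Au su)
      off-s : SupportedIn (complement s) (term (K ─ v) x y)
      off-s B u Bu ¬su = term-outside (K ─ v) x y B
        (⊆ᵇ-false B (V (K ─ v)) u Bu (cong (_∧ not (u ==ᶠ v)) (s⇒¬K (not-false⇒true ¬su))))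

    containing-v : x * y * ΣSub (λ X → if X v then term G x y X else ℤ.0ℤ)
                   ≡ (Q H x y - Q (H ─ v) x y) * (Q K x y - Q (K ─ v) x y)
    containing-v =
      begin
        x * y * ΣSub (λ X → if X v then term G x y X else ℤ.0ℤ)
      ≡⟨ cong (x * y *_) (ΣSub-containing v (term G x y) (term-ext G x y)) ⟩
        x * y * ΣSub (λ X → if X v then ℤ.0ℤ else term G x y (insert v X))
      ≡⟨ sym (ΣSub-* (x * y) (λ X → if X v then ℤ.0ℤ else term G x y (insert v X))) ⟩
        ΣSub (λ X → x * y * (if X v then ℤ.0ℤ else term G x y (insert v X)))
      ≡⟨ ΣSub-cong containing-summand ⟩
        ΣSub (λ X → lift H (X ∩ s) * lift K (X ∩ complement s))
      ≡⟨ product s (lift H) (lift K) (lift-ext H) (lift-ext K) in-s off-s ⟩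
        ΣSub (lift H) * ΣSub (lift K)
      ≡⟨ sym (cong₂ _*_ (difference H) (difference K)) ⟩
        (Q H x y - Q (H ─ v) x y) * (Q K x y - Q (K ─ v) x y)
      ∎
      where
      open ≡-Reasoning
      difference : ∀ H′ → Q H′ x y - Q (H′ ─ v) x y ≡ ΣSub (lift H′)
      difference H′ = trans (Q-difference H′ v x y) (ΣSub-containing v (term H′ x y) (term-ext H′ x y))
      in-s : SupportedIn s (lift H)
      in-s A u Au su with A v in Av
      ... | true = refl
      ... | false = term-outside H x y (insert v A)
                      (⊆ᵇ-false _ (V H) u (∨-trueˡ Au) (trans (sym (s-away (away-from-v Av Au))) su))
      off-s : SupportedIn (complement s) (lift K)
      off-s B u Bu ¬su with B v in Bv
      ... | true = refl
      ... | false = term-outside K x y (insert v B) (⊆ᵇ-false _ (V K) u (∨-trueˡ Bu) (s⇒¬K (not-false⇒true ¬su)))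

theorem6p1 : {n : ℕ} (G H K : Graph n) (v : Fin n) →
    IsSimpleGraph G → IsSimpleGraph H → IsSimpleGraph K →
    IsArticulation G v →
    H ⊆ᴳ G → K ⊆ᴳ G → IsUnion G H K → IsIntersectionSingleVertex H K v →
    (x y : ℤ) →
    x * y * Q G x y
      ≡ x * y * (Q (H ─ v) x y * Q (K ─ v) x y)
        + (Q H x y - Q (H ─ v) x y) * (Q K x y - Q (K ─ v) x y)
theorem6p1 G H K v _ sH sK _ _ _ U I x y =
  begin
    x * y * Q G x y
  ≡⟨ cong (x * y *_) (trans (Q≡ΣSub G x y) (ΣSub-split (term G x y) v)) ⟩
    x * y * (ΣSub (λ X → if X v then term G x y X else ℤ.0ℤ) + ΣSub (λ X → if X v then ℤ.0ℤ else term G x y X))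
  ≡⟨ ℤP.*-distribˡ-+ (x * y) _ _ ⟩
    x * y * ΣSub (λ X → if X v then term G x y X else ℤ.0ℤ) + x * y * ΣSub (λ X → if X v then ℤ.0ℤ else term G x y X)
  ≡⟨ cong₂ _+_ containing-v (cong (x * y *_) avoiding-v) ⟩
    (Q H x y - Q (H ─ v) x y) * (Q K x y - Q (K ─ v) x y) + x * y * (Q (H ─ v) x y * Q (K ─ v) x y)
  ≡⟨ ℤP.+-comm ((Q H x y - Q (H ─ v) x y) * (Q K x y - Q (K ─ v) x y)) _ ⟩
    x * y * (Q (H ─ v) x y * Q (K ─ v) x y) + (Q H x y - Q (H ─ v) x y) * (Q K x y - Q (K ─ v) x y)
  ∎
  where
  open ≡-Reasoning
  open CutVertex.Halves G H K v sH sK U I x y
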